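{- Let $n=\prod_{i=1}^m p_i^{r_i}\geq 2$ be the prime factorization of $n$, let $C_n=\langle a_1\rangle\times\cdots\times\langle a_m\rangle$ with $o(a_i)=p_i^{r_i}$, $a=a_1\cdots a_m$, and $\mathrm{D}_{2n}=\langle a,b\mid a^n=b^2=1,\ bab=a^{ -1}\rangle$. For $x\in\langle a\rangle$ let $\theta_x\in\mathrm{Aut}(\mathrm{D}_{2n})$ be given by $a\mapsto a$, $b\mapsto bx$, and let $\mathrm{Aut}(C_{p_t^{r_t}})$ denote the subgroup of $\mathrm{Aut}(\mathrm{D}_{2n})$ of automorphisms fixing $b$ and every $a_j$ with $j\neq t$ and mapping $\langle a_t\rangle$ to itself. Let $\mathrm{Cay}(\mathrm{D}_{2n},S)$ be a Cayley digraph. Suppose that for some $1\leq t\leq m$ the prime $p_t$ is odd and $\mathrm{Aut}(\mathrm{D}_{2n},S)$ contains an element of order $p_t$ that lies in $\langle\theta_a\rangle\rtimes\mathrm{Aut}(C_{p_t^{r_t}})$ but not in $\langle\theta_a\rangle$. Then $\mathrm{Cay}(\mathrm{D}_{2n},S)$ is not normal.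
   Context: For a group $G$ and $S\subseteq G$ with $1\notin S$, $\mathrm{Cay}(G,S)$ is the digraph with vertex set $G$ and arcs $(g,sg)$, $g\in G$, $s\in S$. $R(g)$ is the permutation $x\mapsto xg$, $R(G)=\{R(g)\mid g\in G\}$, and $\mathrm{Cay}(G,S)$ is normal if $R(G)\trianglelefteq\mathrm{Aut}(\mathrm{Cay}(G,S))$. $\mathrm{Aut}(G,S)=\{\alpha\in\mathrm{Aut}(G)\mid S^\alpha=S\}$. -}

module Defs where

open import Data.Nat using (ℕ; zero; suc; _+_; _*_; _∸_; _<_; NonZero)
open import Data.Nat.DivMod using (_mod_)
open import Data.Fin using (Fin; toℕ)
open import Data.Bool using (Bool; true; false; not)
open import Data.Product using (Σ; ∃; ∃-syntax; _×_; _,_)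
open import Relation.Binary.PropositionalEquality using (_≡_; _≢_)
open import Relation.Nullary using (¬_)

prodℕ : (m : ℕ) → (Fin m → ℕ) → ℕ
prodℕ zero    f = 1
prodℕ (suc m) f = f Fin.zero * prodℕ m (λ i → f (Fin.suc i))

iter : {A : Set} → (A → A) → ℕ → A → A
iter f zero    x = x
iter f (suc k) x = f (iter f k x)

module _ {n : ℕ} .{{_ : NonZero n}} where

  -- The dihedral group D_{2n}: the pair (i , e) stands for a^i b^e.
  D : Set
  D = Fin n × Bool

  addF : Fin n → Fin n → Fin n
  addF i j = (toℕ i + toℕ j) mod n

  negF : Fin n → Fin n
  negF i = (n ∸ toℕ i) mod n

  -- (a^i b^e)(a^j b^f) = a^(i + (-1)^e j) b^(e+f), from b a b = a^{-1}.
  infixl 7 _·_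
  _·_ : D → D → D
  (i , false) · (j , f) = (addF i j , f)
  (i , true)  · (j , f) = (addF i (negF j) , not f)

  one : D
  one = (0 mod n , false)

  aa : D
  aa = (1 mod n , false)

  bb : D
  bb = (0 mod n , true)

  pow : D → ℕ → D
  pow g zero    = one
  pow g (suc k) = g · pow g k

  HasOrder : D → ℕ → Set
  HasOrder g q = 0 < q × pow g q ≡ one × (∀ d → 0 < d → d < q → pow g d ≢ one)

  InCyclic : D → D → Set
  InCyclic g x = ∃[ k ] x ≡ pow g k

  prodD : (m : ℕ) → (Fin m → D) → D
  prodD zero    g = one
  prodD (suc m) g = g Fin.zero · prodD m (λ i → g (Fin.suc i))

  record AutD : Set where
    field
      fun    : D → D
      inv    : D → D
      fun-inv : ∀ x → fun (inv x) ≡ x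
      inv-fun : ∀ x → inv (fun x) ≡ x
      hom    : ∀ x y → fun (x · y) ≡ fun x · fun y
  open AutD public

  -- θ_x : a ↦ a, b ↦ b x  (for x ∈ ⟨a⟩);  a^i b^e ↦ a^i (b x)^e
  theta : D → D → D
  theta x (i , false) = (i , false)
  theta x (i , true)  = (i , false) · (bb · x)

  thetaA : D → D
  thetaA = theta aa

  InThetaA : AutD → Set
  InThetaA α = ∃[ k ] (∀ x → fun α x ≡ iter thetaA k x)

  InAutC : (m : ℕ) → (Fin m → D) → Fin m → AutD → Set
  InAutC m as t β =
    fun β bb ≡ bb
    × (∀ j → j ≢ t → fun β (as j) ≡ as j)
    × (∀ x → InCyclic (as t) x → InCyclic (as t) (fun β x))

  InSemi : (m : ℕ) → (Fin m → D) → Fin m → AutD → Set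
  InSemi m as t α =
    ∃[ k ] Σ AutD (λ β → InAutC m as t β × (∀ x → fun α x ≡ iter thetaA k (fun β x)))

  AutHasOrder : AutD → ℕ → Set
  AutHasOrder α q =
    0 < q × (∀ x → iter (fun α) q x ≡ x)
    × (∀ d → 0 < d → d < q → ¬ (∀ x → iter (fun α) d x ≡ x))

  FixesSet : (D → Set) → AutD → Set
  FixesSet S α = ∀ x → (S x → S (fun α x)) × (S (fun α x) → S x)

  Arc : (D → Set) → D → D → Set
  Arc S x y = Σ D (λ s → S s × y ≡ s · x)

  record Perm : Set where
    field
      pf  : D → D
      pinv : D → D
      pf-pinv : ∀ x → pf (pinv x) ≡ x
      pinv-pf : ∀ x → pinv (pf x) ≡ x
  open Perm public

  IsCayAut : (D → Set) → Perm → Set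
  IsCayAut S σ = ∀ x y → (Arc S x y → Arc S (pf σ x) (pf σ y))
                        × (Arc S (pf σ x) (pf σ y) → Arc S x y)

  -- Cay(D_{2n}, S) is normal: R(D_{2n}) ⊴ Aut(Cay), i.e. σ R(g) σ⁻¹ ∈ R(D_{2n})
  IsNormalCay : (D → Set) → Set
  IsNormalCay S = ∀ σ → IsCayAut S σ → ∀ g → ∃[ h ] (∀ x → pf σ (pinv σ x · g) ≡ x · h)

-- Write α (aᶻ bᵉ) = a^(z (1 + w) + e κ) bᵉ. As α ∈ ⟨θ_a⟩ ⋊ Aut(C_{p^r}), w lies in ⟨a_t⟩, and αᵖ = 1 gives
-- (1 + w)ᵖ = 1 in ℤ/nℤ; lifting the exponent (p odd) yields p w = 0 and w² = 0, while w ≠ 0 as α ∉ ⟨θ_a⟩.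
-- The geometric series then gives p κ = 0, hence κ = L w, and α x = a^(ε x · w) x for a crossed homomorphism ε.
-- Let σ multiply the coset Y = Fix(α) · a on the right by aʷ and fix every other vertex. σ maps arcs to arcs:
-- S is α-invariant, and the α-orbit of any x with ε x · w ≠ 0 is the whole coset x ⟨aʷ⟩, which is where σ could
-- break an arc. But σ fixes 1 and a² and moves a, so σ R(a) σ⁻¹ is no right translation: otherwise
-- σ (a²) = (σ a)², i.e. 2 w = 0, impossible for w ≠ 0 with p w = 0 and p odd.

module Submission where

open import Data.Nat.Base using (ℕ; NonZero)

module NumberTheory where

  open import Defs using (prodℕ)
  open import Data.Nat.Base
  open import Data.Nat.Properties
  open import Data.Nat.Divisibility
  open import Data.Nat.DivMod using (_/_; _%_; m≡m%n+[m/n]*n; m%n<n; m/n*n≡m)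
  open import Data.Nat.Primality using (Prime; euclidsLemma; prime⇒nonZero; prime⇒nonTrivial; prime⇒irreducible)
  open import Data.Nat.Combinatorics using (_C_; nCk+nC[k+1]≡[n+1]C[k+1]; nC1≡n; nCn≡1; k>n⇒nCk≡0; nCk≡n!/k![n-k]!; k![n∸k]!∣n!)
  open import Data.Nat.Tactic.RingSolver using (solve-∀)
  open import Data.Fin.Base using (Fin; zero; suc; punchIn)
  open import Data.Fin.Properties using (punchInᵢ≢i)
  open import Data.Product using (∃-syntax; _×_; _,_; proj₁; proj₂)
  open import Data.Sum using (inj₁; inj₂)
  open import Data.Empty using (⊥-elim)
  open import Function using (_∘_)
  open import Relation.Binary.PropositionalEquality
  open import Relation.Nullary using (¬_; contradiction)

  private
    variable
      p q k m n x : ℕ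

  prime∤1 : Prime p → ¬ p ∣ 1
  prime∤1 pp p∣1 = nonTrivial⇒≢1 {{prime⇒nonTrivial pp}} (∣1⇒≡1 p∣1)

  prime∣prime⇒≡ : Prime p → Prime q → p ∣ q → p ≡ q
  prime∣prime⇒≡ pp pq p∣q with prime⇒irreducible pq p∣q
  ... | inj₁ refl = ⊥-elim (prime∤1 pp ∣-refl)
  ... | inj₂ p≡q = p≡q

  prime∣m^k⇒prime∣m : ∀ k → Prime p → p ∣ m ^ k → p ∣ m
  prime∣m^k⇒prime∣m zero    pp p∣1 = ⊥-elim (prime∤1 pp p∣1)
  prime∣m^k⇒prime∣m {m = m} (suc k) pp p∣m*m^k with euclidsLemma m (m ^ k) pp p∣m*m^k
  ... | inj₁ p∣m   = p∣m
  ... | inj₂ p∣m^k = prime∣m^k⇒prime∣m k pp p∣m^k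

  prime^k∣m*n⇒prime^k∣m : ∀ k → Prime p → ¬ p ∣ n → p ^ k ∣ m * n → p ^ k ∣ m
  prime^k∣m*n⇒prime^k∣m {m = m} zero _ _ _ = 1∣ m
  prime^k∣m*n⇒prime^k∣m {p} {n} {m} (suc k) pp p∤n p^[1+k]∣mn
    with euclidsLemma m n pp (∣-trans (m∣m*n (p ^ k)) p^[1+k]∣mn)
  ... | inj₂ p∣n = contradiction p∣n p∤n
  ... | inj₁ (divides-refl m′) = subst (p * p ^ k ∣_) (*-comm p m′) (*-monoʳ-∣ p p^k∣m′)
    where
      instance _ = prime⇒nonZero pp
      p^k∣m′ : p ^ k ∣ m′
      p^k∣m′ = prime^k∣m*n⇒prime^k∣m k pp p∤n
        (*-cancelˡ-∣ p (subst (p * p ^ k ∣_) (reassoc m′ p n) p^[1+k]∣mn))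
        where
          reassoc : ∀ m′ p n → m′ * p * n ≡ p * (m′ * n)
          reassoc = solve-∀

  prime∤m! : Prime p → m < p → ¬ p ∣ m !
  prime∤m! {m = zero}  pp _   = prime∤1 pp
  prime∤m! {p} {suc m} pp m<p p∣m! with euclidsLemma (suc m) (m !) pp p∣m!
  ... | inj₁ p∣1+m = <⇒≱ m<p (∣⇒≤ p∣1+m)
  ... | inj₂ p∣m!  = prime∤m! pp (<-trans (n<1+n m) m<p) p∣m!

  n∣n! : 0 < n → n ∣ n !
  n∣n! {suc n} _ = m∣m*n (n !)

  prime∣pCk : Prime p → 0 < k → k < p → p ∣ p C k
  prime∣pCk {p} {k} pp 0<k k<p with euclidsLemma (p C k) (k ! * (p ∸ k) !) pp p∣pCk*d
    where
      d = k ! * (p ∸ k) !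
      pCk*d≡p! : (p C k) * d ≡ p !
      pCk*d≡p! = begin
        (p C k) * d                          ≡⟨ cong (_* d) (nCk≡n!/k![n-k]! (<⇒≤ k<p)) ⟩
        (p ! / d) {{k !* (p ∸ k) !≢0}} * d   ≡⟨ m/n*n≡m {{k !* (p ∸ k) !≢0}} (k![n∸k]!∣n! (<⇒≤ k<p)) ⟩
        p !                                  ∎
        where open ≡-Reasoning
      p∣pCk*d : p ∣ (p C k) * d
      p∣pCk*d = subst (p ∣_) (sym pCk*d≡p!) (n∣n! (<-trans 0<k k<p))
  ... | inj₁ p∣pCk = p∣pCk
  ... | inj₂ p∣d with euclidsLemma (k !) ((p ∸ k) !) pp p∣d
  ...   | inj₁ p∣k!     = contradiction p∣k! (prime∤m! pp k<p)
  ...   | inj₂ p∣[p-k]! = contradiction p∣[p-k]! (prime∤m! pp (∸-monoʳ-< 0<k (<⇒≤ k<p)))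

  binomialSum : ℕ → ℕ → ℕ → ℕ
  binomialSum x n zero    = 0
  binomialSum x n (suc N) = binomialSum x n N + (n C N) * x ^ N

  binomialSum-pascal : ∀ x n N → binomialSum x (suc n) (suc N) ≡ binomialSum x n (suc N) + x * binomialSum x n N
  binomialSum-pascal x n zero = sym (cong suc (*-zeroʳ x))
  binomialSum-pascal x n (suc N) = begin
    binomialSum x (suc n) (suc N) + (suc n C suc N) * x ^ suc N
      ≡⟨ cong₂ (λ s c → s + c * x ^ suc N) (binomialSum-pascal x n N) (sym (nCk+nC[k+1]≡[n+1]C[k+1] n N)) ⟩
    binomialSum x n (suc N) + x * binomialSum x n N + ((n C N) + (n C suc N)) * (x * x ^ N)
      ≡⟨ regroup (binomialSum x n (suc N)) (binomialSum x n N) (n C N) (n C suc N) x (x ^ N) ⟩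
    binomialSum x n (suc N) + (n C suc N) * (x * x ^ N) + x * (binomialSum x n N + (n C N) * x ^ N) ∎
    where
      open ≡-Reasoning
      regroup : ∀ s₁ s₀ c₀ c₁ x y → s₁ + x * s₀ + (c₀ + c₁) * (x * y) ≡ s₁ + c₁ * (x * y) + x * (s₀ + c₀ * y)
      regroup = solve-∀

  binomial-theorem : ∀ x n → (1 + x) ^ n ≡ binomialSum x n (suc n)
  binomial-theorem x zero    = refl
  binomial-theorem x (suc n) = begin
    (1 + x) * (1 + x) ^ n                                      ≡⟨ cong ((1 + x) *_) (binomial-theorem x n) ⟩
    (1 + x) * s                                                ≡⟨ expand s (x ^ suc n) x ⟩
    s + 0 * x ^ suc n + x * s                                  ≡⟨ cong (λ c → s + c * x ^ suc n + x * s) (sym (k>n⇒nCk≡0 (n<1+n n))) ⟩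
    binomialSum x n (suc (suc n)) + x * s                      ≡⟨ binomialSum-pascal x n (suc n) ⟨
    binomialSum x (suc n) (suc (suc n))                        ∎
    where
      open ≡-Reasoning
      s = binomialSum x n (suc n)
      expand : ∀ s y x → (1 + x) * s ≡ s + 0 * y + x * s
      expand = solve-∀

  binomialSum-middle : Prime p → ∀ x N → N < p → ∃[ K ] binomialSum x p (suc N) ≡ 1 + p * K
  binomialSum-middle {p} pp x zero    _ = 0 , sym (cong suc (*-zeroʳ p))
  binomialSum-middle {p} pp x (suc N) N<p
    with binomialSum-middle pp x N (<-trans (n<1+n N) N<p) | prime∣pCk pp (s≤s z≤n) N<p
  ... | K , eq | divides c pCN≡c*p = K + c * x ^ suc N , (begin
    binomialSum x p (suc N) + (p C suc N) * x ^ suc N ≡⟨ cong₂ (λ s c → s + c * x ^ suc N) eq pCN≡c*p ⟩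
    1 + p * K + c * p * x ^ suc N                     ≡⟨ factor p K c (x ^ suc N) ⟩
    1 + p * (K + c * x ^ suc N)                       ∎)
    where
      open ≡-Reasoning
      factor : ∀ p K c y → 1 + p * K + c * p * y ≡ 1 + p * (K + c * y)
      factor = solve-∀

  frobenius : Prime p → ∀ x → ∃[ K ] (1 + x) ^ p ≡ 1 + (p * K + x ^ p)
  frobenius {zero}  pp = ⊥-elim (NonZero.nonZero (prime⇒nonZero pp))
  frobenius {p@(suc q)} pp x with binomialSum-middle pp x q ≤-refl
  ... | K , eq = K , (begin
    (1 + x) ^ p                                        ≡⟨ binomial-theorem x p ⟩
    binomialSum x p (suc q) + (p C p) * x ^ p          ≡⟨ cong₂ (λ s c → s + c * x ^ p) eq (nCn≡1 p) ⟩
    1 + p * K + 1 * x ^ p                              ≡⟨ regroup p K (x ^ p) ⟩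
    1 + (p * K + x ^ p)                                ∎)
    where
      open ≡-Reasoning
      regroup : ∀ p K y → 1 + p * K + 1 * y ≡ 1 + (p * K + y)
      regroup = solve-∀

  [1+n]C2≡n+nC2 : ∀ n → suc n C 2 ≡ n + (n C 2)
  [1+n]C2≡n+nC2 n = trans (sym (nCk+nC[k+1]≡[n+1]C[k+1] n 1)) (cong (_+ (n C 2)) (nC1≡n n))

  second-order-expansion : ∀ x j → ∃[ G ] (1 + x) ^ j ≡ 1 + j * x + (j C 2) * (x * x) + x * x * x * G
  second-order-expansion x zero    = 0 , base x
    where
      base : ∀ x → 1 ≡ 1 + 0 * x + 0 * (x * x) + x * x * x * 0
      base = solve-∀
  second-order-expansion x (suc j) with second-order-expansion x j
  ... | G , eq = (j C 2) + G + x * G , (begin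
    (1 + x) * (1 + x) ^ j                                           ≡⟨ cong ((1 + x) *_) eq ⟩
    (1 + x) * (1 + j * x + (j C 2) * (x * x) + x * x * x * G)       ≡⟨ expand x j (j C 2) G ⟩
    1 + suc j * x + (j + (j C 2)) * (x * x) + x * x * x * ((j C 2) + G + x * G)
      ≡⟨ cong (λ c → 1 + suc j * x + c * (x * x) + x * x * x * ((j C 2) + G + x * G)) ([1+n]C2≡n+nC2 j) ⟨
    1 + suc j * x + (suc j C 2) * (x * x) + x * x * x * ((j C 2) + G + x * G) ∎)
    where
      open ≡-Reasoning
      expand : ∀ x j c G → (1 + x) * (1 + j * x + c * (x * x) + x * x * x * G)
                         ≡ 1 + (1 + j) * x + (j + c) * (x * x) + x * x * x * (c + G + x * G)
      expand = solve-∀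

  2*[1+n]C2≡[1+n]*n : ∀ n → 2 * (suc n C 2) ≡ suc n * n
  2*[1+n]C2≡[1+n]*n zero    = refl
  2*[1+n]C2≡[1+n]*n (suc n) = begin
    2 * (suc (suc n) C 2)              ≡⟨ cong (2 *_) ([1+n]C2≡n+nC2 (suc n)) ⟩
    2 * (suc n + (suc n C 2))          ≡⟨ *-distribˡ-+ 2 (suc n) (suc n C 2) ⟩
    2 * suc n + 2 * (suc n C 2)        ≡⟨ cong (2 * suc n +_) (2*[1+n]C2≡[1+n]*n n) ⟩
    2 * suc n + suc n * n              ≡⟨ regroup n ⟩
    suc (suc n) * suc n                ∎
    where
      open ≡-Reasoning
      regroup : ∀ n → 2 * (1 + n) + (1 + n) * n ≡ (2 + n) * (1 + n)
      regroup = solve-∀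

  odd-C2 : ∀ h → suc (2 * h) C 2 ≡ suc (2 * h) * h
  odd-C2 h = *-cancelˡ-≡ (suc (2 * h) C 2) (suc (2 * h) * h) 2 (begin
    2 * (suc (2 * h) C 2)     ≡⟨ 2*[1+n]C2≡[1+n]*n (2 * h) ⟩
    suc (2 * h) * (2 * h)     ≡⟨ x∙yz≈y∙xz (suc (2 * h)) 2 h ⟩
    2 * (suc (2 * h) * h)     ∎)
    where
      open ≡-Reasoning
      open import Algebra.Properties.CommutativeSemigroup *-commutativeSemigroup using (x∙yz≈y∙xz)

  odd⇒≡1+2* : ¬ 2 ∣ p → ∃[ h ] p ≡ suc (2 * h)
  odd⇒≡1+2* {p} 2∤p with p % 2 in p%2≡r | m%n<n p 2
  ... | 0 | _ = contradiction (m%n≡0⇒n∣m p 2 p%2≡r) 2∤p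
  ... | 1 | _ = p / 2 , (begin
    p                  ≡⟨ m≡m%n+[m/n]*n p 2 ⟩
    p % 2 + p / 2 * 2  ≡⟨ cong₂ _+_ p%2≡r (*-comm (p / 2) 2) ⟩
    1 + 2 * (p / 2)    ∎)
    where open ≡-Reasoning
  ... | suc (suc _) | s≤s (s≤s ())

  prime∣[1+x]^p∸1⇒prime∣x : Prime p → p ∣ (1 + x) ^ p ∸ 1 → p ∣ x
  prime∣[1+x]^p∸1⇒prime∣x {p} {x} pp p∣[1+x]^p∸1 with frobenius pp x
  ... | K , eq = prime∣m^k⇒prime∣m p pp (∣m+n∣m⇒∣n (subst (λ y → p ∣ y ∸ 1) eq p∣[1+x]^p∸1) (m∣m*n K))

  odd-prime-power-expansion : ∀ {h} z → p ≡ suc (2 * h) → ∃[ V ] (1 + z * p) ^ p ≡ 1 + p * (z * p * (1 + p * V))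
  odd-prime-power-expansion {p} {h} z p-odd with second-order-expansion (z * p) p
  ... | G , eq = h * z + z * z * G , (begin
    (1 + y) ^ p                                              ≡⟨ eq ⟩
    1 + p * y + (p C 2) * (y * y) + y * y * y * G            ≡⟨ cong (λ c → 1 + p * y + c * (y * y) + y * y * y * G) pC2≡p*h ⟩
    1 + p * y + p * h * (y * y) + y * y * y * G              ≡⟨ factor p h z G ⟩
    1 + p * (y * (1 + p * (h * z + z * z * G)))              ∎)
    where
      open ≡-Reasoning
      y = z * p
      pC2≡p*h : p C 2 ≡ p * h
      pC2≡p*h = subst (λ p → p C 2 ≡ p * h) (sym p-odd) (odd-C2 h)
      factor : ∀ p h z G → 1 + p * (z * p) + p * h * (z * p * (z * p)) + z * p * (z * p) * (z * p) * G
                         ≡ 1 + p * (z * p * (1 + p * (h * z + z * z * G)))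
      factor = solve-∀

  lifting-the-exponent : ∀ {h} k → Prime p → p ≡ suc (2 * h) → p ^ suc k ∣ (1 + x) ^ p ∸ 1 → p ∣ x × p ^ k ∣ x
  lifting-the-exponent {p} {x} {h} k pp p-odd p^[1+k]∣
    with prime∣[1+x]^p∸1⇒prime∣x pp (∣-trans (m∣m*n (p ^ k)) p^[1+k]∣)
  ... | p∣x@(divides-refl z) with odd-prime-power-expansion {h = h} z p-odd
  ...   | V , eq = p∣x , prime^k∣m*n⇒prime^k∣m k pp p∤1+pV (*-cancelˡ-∣ p p^[1+k]∣p*[x*[1+pV]])
    where
      instance _ = prime⇒nonZero pp
      p^[1+k]∣p*[x*[1+pV]] : p * p ^ k ∣ p * (z * p * (1 + p * V))
      p^[1+k]∣p*[x*[1+pV]] = subst (λ y → p ^ suc k ∣ y ∸ 1) eq p^[1+k]∣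
      p∤1+pV : ¬ p ∣ 1 + p * V
      p∤1+pV p∣1+pV = prime∤1 pp (∣m+n∣m⇒∣n (subst (p ∣_) (+-comm 1 (p * V)) p∣1+pV) (m∣m*n V))

  order-p-unit⇒square-zero : ∀ {h M W} k → Prime p → p ≡ suc (2 * h) → ¬ p ∣ M
    → p ^ suc k * M ∣ p ^ suc k * W → p ^ suc k * M ∣ (1 + W) ^ p ∸ 1
    → p ^ suc k * M ∣ p * W × p ^ suc k * M ∣ W * W
  order-p-unit⇒square-zero {p} {h} {M} k pp p-odd p∤M n∣p^[1+k]W n∣[1+W]^p∸1
    with *-cancelˡ-∣ (p ^ suc k) {{m^n≢0 p (suc k) {{prime⇒nonZero pp}}}} n∣p^[1+k]W
  ... | divides-refl y = n∣pW , n∣W²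
    where
      p^[1+k]∣[1+W]^p∸1 = m*n∣⇒m∣ (p ^ suc k) M n∣[1+W]^p∸1
      p∣yM×p^k∣yM = lifting-the-exponent {h = h} k pp p-odd p^[1+k]∣[1+W]^p∸1
      p∣y : p ∣ y
      p∣y with euclidsLemma y M pp (proj₁ p∣yM×p^k∣yM)
      ... | inj₁ p∣y = p∣y
      ... | inj₂ p∣M = contradiction p∣M p∤M
      p^k∣y : p ^ k ∣ y
      p^k∣y = prime^k∣m*n⇒prime^k∣m k pp p∤M (proj₂ p∣yM×p^k∣yM)
      n∣pW : p ^ suc k * M ∣ p * (y * M)
      n∣pW = subst (p ^ suc k * M ∣_) (*-assoc p y M) (*-monoˡ-∣ M (*-monoʳ-∣ p p^k∣y))
      n∣W² : p ^ suc k * M ∣ y * M * (y * M)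
      n∣W² = subst (p ^ suc k * M ∣_) (regroup y M) (*-pres-∣ (*-pres-∣ p∣y p^k∣y) (m∣m*n M))
        where
          regroup : ∀ y M → y * y * (M * M) ≡ y * M * (y * M)
          regroup = solve-∀

  prodℕ-punchIn : ∀ m (f : Fin (suc m) → ℕ) t → prodℕ (suc m) f ≡ f t * prodℕ m (f ∘ punchIn t)
  prodℕ-punchIn m       f zero    = refl
  prodℕ-punchIn (suc m) f (suc t) = begin
    f zero * prodℕ (suc m) (f ∘ suc)                    ≡⟨ cong (f zero *_) (prodℕ-punchIn m (f ∘ suc) t) ⟩
    f zero * (f (suc t) * prodℕ m (f ∘ suc ∘ punchIn t)) ≡⟨ x∙yz≈y∙xz (f zero) (f (suc t)) _ ⟩
    f (suc t) * (f zero * prodℕ m (f ∘ suc ∘ punchIn t)) ∎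
    where
      open ≡-Reasoning
      open import Algebra.Properties.CommutativeSemigroup *-commutativeSemigroup using (x∙yz≈y∙xz)

  prime∤prodℕ : Prime q → ∀ m (f : Fin m → ℕ) → (∀ i → ¬ q ∣ f i) → ¬ q ∣ prodℕ m f
  prime∤prodℕ pq zero    f q∤f = prime∤1 pq
  prime∤prodℕ pq (suc m) f q∤f q∣prod with euclidsLemma (f zero) (prodℕ m (f ∘ suc)) pq q∣prod
  ... | inj₁ q∣f0    = q∤f zero q∣f0
  ... | inj₂ q∣prod′ = prime∤prodℕ pq m (f ∘ suc) (q∤f ∘ suc) q∣prod′

  prime-power-cofactor : ∀ m (p r : Fin m → ℕ) → (∀ i → Prime (p i)) → (∀ i j → p i ≡ p j → i ≡ j) →
    ∀ t → ∃[ M ] prodℕ m (λ i → p i ^ r i) ≡ p t ^ r t * M × ¬ p t ∣ M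
  prime-power-cofactor (suc m) p r prime injective t =
    _ , prodℕ-punchIn m (λ i → p i ^ r i) t , prime∤prodℕ (prime t) m _ p[t]∤others
    where
      p[t]∤others : ∀ i → ¬ p t ∣ p (punchIn t i) ^ r (punchIn t i)
      p[t]∤others i p[t]∣ = punchInᵢ≢i t i (sym (injective t (punchIn t i)
        (prime∣prime⇒≡ (prime t) (prime (punchIn t i)) (prime∣m^k⇒prime∣m (r (punchIn t i)) (prime t) p[t]∣))))

module ModularArithmetic where

  open NumberTheory using ([1+n]C2≡n+nC2; odd-C2; order-p-unit⇒square-zero)
  open import Data.Nat.Base as ℕ using (ℕ; NonZero)
  import Data.Nat.Properties as ℕ
  import Data.Nat.Divisibility as ℕ∣
  open import Data.Nat.Primality using (Prime; prime⇒nonZero)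
  open import Data.Nat.Coprimality using (coprime-Bézout; prime⇒coprime)
  open import Data.Nat.GCD using (module Bézout)
  open import Data.Nat.Combinatorics using (_C_)
  open import Data.Integer.Base using (ℤ; +_; -_; _+_; _-_; _*_; _^_; 0ℤ; 1ℤ; -1ℤ; _%ℕ_; _/ℕ_)
  import Data.Integer.Properties as ℤ
  open import Data.Integer.DivMod using (n%ℕd<d; a≡a%ℕn+[a/ℕn]*n)
  open import Data.Integer.Divisibility.Signed as ℤ∣ using (divides)
  open import Data.Integer.Tactic.RingSolver using (solve-∀)
  open import Data.Product using (∃-syntax; _×_; _,_; proj₁; proj₂)
  open import Relation.Binary.Bundles using (Setoid)
  open import Relation.Binary.PropositionalEquality using (_≡_; refl; sym; trans; cong; cong₂; subst; module ≡-Reasoning)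
  import Relation.Binary.Reasoning.Setoid
  open import Relation.Nullary using (Dec; ¬_; contradiction)
  open import Relation.Nullary.Decidable using (map′)

  infix 4 _≡_[mod_]
  record _≡_[mod_] (x y : ℤ) (m : ℕ) : Set where
    constructor congruent
    field divides-difference : + m ℤ∣.∣ x - y
  open _≡_[mod_] public

  module _ {m : ℕ} where

    private
      congruent-by : ∀ {x y a} → a ≡ x - y → + m ℤ∣.∣ a → x ≡ y [mod m ]
      congruent-by eq m∣a = congruent (subst (+ m ℤ∣.∣_) eq m∣a)

    ≡-mod-refl : ∀ {x} → x ≡ x [mod m ]
    ≡-mod-refl {x} = congruent-by (sym (ℤ.+-inverseʳ x)) (divides 0ℤ refl)

    ≡-mod-reflexive : ∀ {x y} → x ≡ y → x ≡ y [mod m ]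
    ≡-mod-reflexive refl = ≡-mod-refl

    ≡-mod-sym : ∀ {x y} → x ≡ y [mod m ] → y ≡ x [mod m ]
    ≡-mod-sym {x} {y} (congruent m∣x-y) = congruent-by (eq x y) (ℤ∣.∣m⇒∣-m m∣x-y)
      where
        eq : ∀ x y → - (x - y) ≡ y - x
        eq = solve-∀

    ≡-mod-trans : ∀ {x y z} → x ≡ y [mod m ] → y ≡ z [mod m ] → x ≡ z [mod m ]
    ≡-mod-trans {x} {y} {z} (congruent xy) (congruent yz) = congruent-by (eq x y z) (ℤ∣.∣m∣n⇒∣m+n xy yz)
      where
        eq : ∀ x y z → (x - y) + (y - z) ≡ x - z
        eq = solve-∀

    +-cong-mod : ∀ {x x′ y y′} → x ≡ x′ [mod m ] → y ≡ y′ [mod m ] → x + y ≡ x′ + y′ [mod m ]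
    +-cong-mod {x} {x′} {y} {y′} (congruent xx) (congruent yy) =
      congruent-by (eq x x′ y y′) (ℤ∣.∣m∣n⇒∣m+n xx yy)
      where
        eq : ∀ x x′ y y′ → (x - x′) + (y - y′) ≡ (x + y) - (x′ + y′)
        eq = solve-∀

    *-cong-mod : ∀ {x x′ y y′} → x ≡ x′ [mod m ] → y ≡ y′ [mod m ] → x * y ≡ x′ * y′ [mod m ]
    *-cong-mod {x} {x′} {y} {y′} (congruent xx) (congruent yy) =
      congruent-by (eq x x′ y y′) (ℤ∣.∣m∣n⇒∣m+n (ℤ∣.∣n⇒∣m*n x yy) (ℤ∣.∣m⇒∣m*n y′ xx))
      where
        eq : ∀ x x′ y y′ → x * (y - y′) + (x - x′) * y′ ≡ x * y - x′ * y′
        eq = solve-∀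

    +-congˡ-mod : ∀ x {y y′} → y ≡ y′ [mod m ] → x + y ≡ x + y′ [mod m ]
    +-congˡ-mod x = +-cong-mod (≡-mod-refl {x})

    +-congʳ-mod : ∀ y {x x′} → x ≡ x′ [mod m ] → x + y ≡ x′ + y [mod m ]
    +-congʳ-mod y x≡x′ = +-cong-mod x≡x′ (≡-mod-refl {y})

    *-congˡ-mod : ∀ x {y y′} → y ≡ y′ [mod m ] → x * y ≡ x * y′ [mod m ]
    *-congˡ-mod x = *-cong-mod (≡-mod-refl {x})

    *-congʳ-mod : ∀ y {x x′} → x ≡ x′ [mod m ] → x * y ≡ x′ * y [mod m ]
    *-congʳ-mod y x≡x′ = *-cong-mod x≡x′ (≡-mod-refl {y})

    -‿cong-mod : ∀ {x x′} → x ≡ x′ [mod m ] → - x ≡ - x′ [mod m ]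
    -‿cong-mod {x} {x′} (congruent xx) = congruent-by (eq x x′) (ℤ∣.∣m⇒∣-m xx)
      where
        eq : ∀ x x′ → - (x - x′) ≡ - x - - x′
        eq = solve-∀

    ∣⇒≡0-mod : ∀ {x} → + m ℤ∣.∣ x → x ≡ 0ℤ [mod m ]
    ∣⇒≡0-mod {x} = congruent-by (sym (ℤ.+-identityʳ x))

    ≡0-mod⇒∣ : ∀ {x} → x ≡ 0ℤ [mod m ] → + m ℤ∣.∣ x
    ≡0-mod⇒∣ {x} (congruent m∣x) = subst (+ m ℤ∣.∣_) (ℤ.+-identityʳ x) m∣x

    +-multiple-mod : ∀ x q → x + q * + m ≡ x [mod m ]
    +-multiple-mod x q = congruent-by (eq x q (+ m)) (divides q refl)
      where
        eq : ∀ x q M → q * M ≡ (x + q * M) - x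
        eq = solve-∀

    +-identityʳ-mod : ∀ a {x} → x ≡ 0ℤ [mod m ] → a + x ≡ a [mod m ]
    +-identityʳ-mod a x≡0 = ≡-mod-trans (+-congˡ-mod a x≡0) (≡-mod-reflexive (ℤ.+-identityʳ a))

    +-absorb-mod : ∀ a b {x} → x ≡ 0ℤ [mod m ] → a + b * x ≡ a [mod m ]
    +-absorb-mod a b x≡0 = +-identityʳ-mod a (≡-mod-trans (*-congˡ-mod b x≡0) (≡-mod-reflexive (ℤ.*-zeroʳ b)))

    ^-cong-mod : ∀ k {x y} → x ≡ y [mod m ] → x ^ k ≡ y ^ k [mod m ]
    ^-cong-mod ℕ.zero    _   = ≡-mod-refl
    ^-cong-mod (ℕ.suc k) x≡y = *-cong-mod x≡y (^-cong-mod k x≡y)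

    ℕ-∣⇒≡0-mod : ∀ {a} → m ℕ∣.∣ a → + a ≡ 0ℤ [mod m ]
    ℕ-∣⇒≡0-mod m∣a = ∣⇒≡0-mod (ℤ∣.∣ᵤ⇒∣ m∣a)

    ≡0-mod⇒ℕ-∣ : ∀ {a} → + a ≡ 0ℤ [mod m ] → m ℕ∣.∣ a
    ≡0-mod⇒ℕ-∣ a≡0 = ℤ∣.∣⇒∣ᵤ (≡0-mod⇒∣ a≡0)

    ≡-mod-setoid : Setoid _ _
    ≡-mod-setoid = record
      { Carrier = ℤ
      ; _≈_ = _≡_[mod m ]
      ; isEquivalence = record { refl = ≡-mod-refl ; sym = ≡-mod-sym ; trans = ≡-mod-trans }
      }

  infix 4 _≡?_[mod_]
  _≡?_[mod_] : ∀ x y m → Dec (x ≡ y [mod m ])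
  x ≡? y [mod m ] = map′ congruent divides-difference (+ m ℤ∣.∣? x - y)

  module ≡-mod-Reasoning (m : ℕ) = Relation.Binary.Reasoning.Setoid (≡-mod-setoid {m})

  pos-^ : ∀ a k → + (a ℕ.^ k) ≡ (+ a) ^ k
  pos-^ a ℕ.zero    = refl
  pos-^ a (ℕ.suc k) = trans (ℤ.pos-* a (a ℕ.^ k)) (cong (λ t → + a * t) (pos-^ a k))

  %ℕ-mod : ∀ z m .{{_ : NonZero m}} → + (z %ℕ m) ≡ z [mod m ]
  %ℕ-mod z m = ≡-mod-sym (subst (_≡ + (z %ℕ m) [mod m ]) (sym (a≡a%ℕn+[a/ℕn]*n z m)) (+-multiple-mod _ (z /ℕ m)))

  inverse-mod-prime : ∀ {p e} → Prime p → ¬ e ≡ 0ℤ [mod p ] → ∃[ u ] u * e ≡ 1ℤ [mod p ]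
  inverse-mod-prime {p} {e} pp e≢0 = invert (e %ℕ p) refl
    where
      open ≡-Reasoning
      instance _ = prime⇒nonZero pp
      e≡e%p : e ≡ + (e %ℕ p) [mod p ]
      e≡e%p = ≡-mod-sym (%ℕ-mod e p)
      pos-+-* : ∀ a b c {d} → a ℕ.+ b ℕ.* c ≡ d → + a + + b * + c ≡ + d
      pos-+-* a b c eq = trans (cong (λ t → + a + t) (sym (ℤ.pos-* b c))) (trans (sym (ℤ.pos-+ a (b ℕ.* c))) (cong +_ eq))
      invert : ∀ r → e %ℕ p ≡ r → ∃[ u ] u * e ≡ 1ℤ [mod p ]
      invert ℕ.zero    e%p≡0 = contradiction (subst (λ r → e ≡ + r [mod p ]) e%p≡0 e≡e%p) e≢0
      invert (ℕ.suc r) e%p≡s = bézout (coprime-Bézout (prime⇒coprime pp (subst (ℕ._< p) e%p≡s (n%ℕd<d e p))))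
        where
          s = ℕ.suc r
          e≡s : e ≡ + s [mod p ]
          e≡s = subst (λ r → e ≡ + r [mod p ]) e%p≡s e≡e%p
          bézout : Bézout.Identity 1 p s → ∃[ u ] u * e ≡ 1ℤ [mod p ]
          bézout (Bézout.+- x y 1+ys≡xp) = - + y , ≡-mod-trans (*-congˡ-mod (- + y) e≡s) (congruent (divides (- + x) (begin
            - + y * + s - 1ℤ      ≡⟨ negate (+ y) (+ s) ⟩
            - (1ℤ + + y * + s)    ≡⟨ cong -_ (pos-+-* 1 y s 1+ys≡xp) ⟩
            - + (x ℕ.* p)         ≡⟨ cong -_ (ℤ.pos-* x p) ⟩
            - (+ x * + p)         ≡⟨ ℤ.neg-distribˡ-* (+ x) (+ p) ⟩
            - + x * + p           ∎)))
            where
              negate : ∀ y s → - y * s - 1ℤ ≡ - (1ℤ + y * s)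
              negate = solve-∀
          bézout (Bézout.-+ x y 1+xp≡ys) = + y , ≡-mod-trans (*-congˡ-mod (+ y) e≡s) (congruent (divides (+ x) (begin
            + y * + s - 1ℤ        ≡⟨ cong (λ t → t - 1ℤ) (sym (ℤ.pos-* y s)) ⟩
            + (y ℕ.* s) - 1ℤ      ≡⟨ cong (λ t → t - 1ℤ) (sym (pos-+-* 1 x p 1+xp≡ys)) ⟩
            1ℤ + + x * + p - 1ℤ   ≡⟨ cancel (+ x * + p) ⟩
            + x * + p             ∎)))
            where
              cancel : ∀ a → 1ℤ + a - 1ℤ ≡ a
              cancel = solve-∀

  solve-mod-prime : ∀ {p e} → Prime p → ¬ e ≡ 0ℤ [mod p ] → ∀ t → ∃[ k ] + k * e ≡ t [mod p ]
  solve-mod-prime {p} {e} pp e≢0 t with inverse-mod-prime pp e≢0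
  ... | u , ue≡1 = (t * u) %ℕ p , (begin
    + ((t * u) %ℕ p) * e    ≈⟨ *-congʳ-mod e (%ℕ-mod (t * u) p) ⟩
    t * u * e               ≡⟨ ℤ.*-assoc t u e ⟩
    t * (u * e)             ≈⟨ *-congˡ-mod t ue≡1 ⟩
    t * 1ℤ                  ≡⟨ ℤ.*-identityʳ t ⟩
    t                       ∎)
    where
      instance _ = prime⇒nonZero pp
      open ≡-mod-Reasoning p

  *-congʳ-mod-torsion : ∀ {p m w x y} → + p * w ≡ 0ℤ [mod m ] → x ≡ y [mod p ] → x * w ≡ y * w [mod m ]
  *-congʳ-mod-torsion {p} {m} {w} {x} {y} pw≡0 (congruent (divides q x-y≡qp)) = congruent (subst (+ m ℤ∣.∣_) (sym (begin
    x * w - y * w     ≡⟨ distrib x y w ⟩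
    (x - y) * w       ≡⟨ cong (_* w) x-y≡qp ⟩
    q * + p * w       ≡⟨ ℤ.*-assoc q (+ p) w ⟩
    q * (+ p * w)     ∎)) (ℤ∣.∣n⇒∣m*n q (≡0-mod⇒∣ pw≡0)))
    where
      open ≡-Reasoning
      distrib : ∀ x y w → x * w - y * w ≡ (x - y) * w
      distrib = solve-∀

  p-torsion-multiple : ∀ {p m w κ} → Prime p → + p * w ≡ 0ℤ [mod m ] → + p * κ ≡ 0ℤ [mod m ] → ¬ w ≡ 0ℤ [mod m ]
    → ∃[ L ] κ ≡ L * w [mod m ]
  p-torsion-multiple {p} {m} {w} {κ} pp pw≡0 pκ≡0 w≢0 with ≡0-mod⇒∣ pw≡0 | ≡0-mod⇒∣ pκ≡0
  ... | divides cw pw≡cw*m | divides cκ pκ≡cκ*m with inverse-mod-prime pp cw≢0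
    where
      instance _ = prime⇒nonZero pp
      cw≢0 : ¬ cw ≡ 0ℤ [mod p ]
      cw≢0 cw≡0 with ≡0-mod⇒∣ cw≡0
      ... | divides d cw≡d*p = w≢0 (∣⇒≡0-mod (divides d (ℤ.*-cancelˡ-≡ (+ p) w (d * + m) (begin
        + p * w           ≡⟨ pw≡cw*m ⟩
        cw * + m          ≡⟨ cong (_* + m) cw≡d*p ⟩
        d * + p * + m     ≡⟨ regroup d (+ p) (+ m) ⟩
        + p * (d * + m)   ∎))))
        where
          open ≡-Reasoning
          regroup : ∀ d p m → d * p * m ≡ p * (d * m)
          regroup = solve-∀
  ... | u , ucw≡1 = cκ * u , congruent (ℤ∣.*-cancelˡ-∣ (+ p) (subst (+ p * + m ℤ∣.∣_) eq (ℤ∣.*-monoˡ-∣ (+ m) p∣cκ-Lcw)))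
    where
      open ≡-Reasoning
      instance _ = prime⇒nonZero pp
      p∣cκ-Lcw : + p ℤ∣.∣ cκ - cκ * u * cw
      p∣cκ-Lcw = subst (+ p ℤ∣.∣_) (factor cκ u cw) (ℤ∣.∣n⇒∣m*n (- cκ) (divides-difference ucw≡1))
        where
          factor : ∀ c u v → - c * (u * v - 1ℤ) ≡ c - c * u * v
          factor = solve-∀
      eq : (cκ - cκ * u * cw) * + m ≡ + p * (κ - cκ * u * w)
      eq = begin
        (cκ - cκ * u * cw) * + m             ≡⟨ expand cκ u cw (+ m) ⟩
        cκ * + m - cκ * u * (cw * + m)       ≡⟨ cong₂ (λ a b → a - cκ * u * b) pκ≡cκ*m pw≡cw*m ⟨
        + p * κ - cκ * u * (+ p * w)         ≡⟨ regroup (+ p) κ (cκ * u) w ⟩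
        + p * (κ - cκ * u * w)               ∎
        where
          expand : ∀ c u v m → (c - c * u * v) * m ≡ c * m - c * u * (v * m)
          expand = solve-∀
          regroup : ∀ p κ l w → p * κ - l * (p * w) ≡ p * (κ - l * w)
          regroup = solve-∀

  geometric : ℤ → ℕ → ℤ
  geometric v ℕ.zero    = 0ℤ
  geometric v (ℕ.suc j) = 1ℤ + v * geometric v j

  geometric-square-zero : ∀ {m w} → w * w ≡ 0ℤ [mod m ] → ∀ j → geometric (1ℤ + w) j ≡ + j + + (j C 2) * w [mod m ]
  geometric-square-zero {m} {w} w²≡0 ℕ.zero    = ≡-mod-reflexive (sym (trans (ℤ.+-identityˡ _) (ℤ.*-zeroˡ w)))
  geometric-square-zero {m} {w} w²≡0 (ℕ.suc j) = begin
    1ℤ + (1ℤ + w) * geometric (1ℤ + w) j               ≈⟨ +-congˡ-mod 1ℤ (*-congˡ-mod (1ℤ + w) (geometric-square-zero w²≡0 j)) ⟩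
    1ℤ + (1ℤ + w) * (+ j + + (j C 2) * w)              ≡⟨ expand (+ j) (+ (j C 2)) w ⟩
    1ℤ + + j + (+ j + + (j C 2)) * w + + (j C 2) * (w * w) ≈⟨ +-absorb-mod _ (+ (j C 2)) w²≡0 ⟩
    1ℤ + + j + (+ j + + (j C 2)) * w                   ≡⟨ cong₂ (λ a b → a + b * w) (sym (ℤ.pos-+ 1 j)) (sym +[1+j]C2) ⟩
    + ℕ.suc j + + (ℕ.suc j C 2) * w                    ∎
    where
      open ≡-mod-Reasoning m
      expand : ∀ j c w → 1ℤ + (1ℤ + w) * (j + c * w) ≡ 1ℤ + j + (j + c) * w + c * (w * w)
      expand = solve-∀
      +[1+j]C2 : + (ℕ.suc j C 2) ≡ + j + + (j C 2)
      +[1+j]C2 = trans (cong +_ ([1+n]C2≡n+nC2 j)) (ℤ.pos-+ j (j C 2))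

  geometric-odd-order : ∀ {m p h w} → p ≡ ℕ.suc (2 ℕ.* h) → + p * w ≡ 0ℤ [mod m ] → w * w ≡ 0ℤ [mod m ]
    → geometric (1ℤ + w) p ≡ + p [mod m ]
  geometric-odd-order {m} {p} {h} {w} p-odd pw≡0 w²≡0 = begin
    geometric (1ℤ + w) p          ≈⟨ geometric-square-zero w²≡0 p ⟩
    + p + + (p C 2) * w           ≡⟨ cong (λ c → + p + c * w) +pC2≡h*p ⟩
    + p + + h * + p * w           ≡⟨ cong (λ t → + p + t) (ℤ.*-assoc (+ h) (+ p) w) ⟩
    + p + + h * (+ p * w)         ≈⟨ +-absorb-mod (+ p) (+ h) pw≡0 ⟩
    + p                           ∎
    where
      open ≡-mod-Reasoning m
      +pC2≡h*p : + (p C 2) ≡ + h * + p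
      +pC2≡h*p = trans (cong +_ (subst (λ p → p C 2 ≡ p ℕ.* h) (sym p-odd) (odd-C2 h))) (trans (ℤ.pos-* p h) (ℤ.*-comm (+ p) (+ h)))

  unipotent-of-order-p : ∀ {n p h r M w} .{{_ : NonZero n}} → Prime p → p ≡ ℕ.suc (2 ℕ.* h) → ¬ p ℕ∣.∣ M → 1 ℕ.≤ r
    → n ≡ p ℕ.^ r ℕ.* M → + (p ℕ.^ r) * w ≡ 0ℤ [mod n ] → (1ℤ + w) ^ p ≡ 1ℤ [mod n ]
    → + p * w ≡ 0ℤ [mod n ] × w * w ≡ 0ℤ [mod n ]
  unipotent-of-order-p {n} {p} {h} {ℕ.suc k} {M} {w} pp p-odd p∤M (ℕ.s≤s ℕ.z≤n) n≡ qw≡0 [1+w]^p≡1 =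
    scale p (proj₁ p^[1+k]M∣pW×W²) , ≡-mod-trans (*-congʳ-mod w (≡-mod-sym W≡w)) (scale W (proj₂ p^[1+k]M∣pW×W²))
    where
      W = w %ℕ n
      W≡w : + W ≡ w [mod n ]
      W≡w = %ℕ-mod w n
      q = p ℕ.^ ℕ.suc k
      scale : ∀ a → q ℕ.* M ℕ∣.∣ a ℕ.* W → + a * w ≡ 0ℤ [mod n ]
      scale a ∣aW = ≡-mod-trans (*-congˡ-mod (+ a) (≡-mod-sym W≡w))
                      (≡-mod-trans (≡-mod-reflexive (sym (ℤ.pos-* a W))) (ℕ-∣⇒≡0-mod (subst (ℕ∣._∣ a ℕ.* W) (sym n≡) ∣aW)))
      n∣qW : n ℕ∣.∣ q ℕ.* W
      n∣qW = ≡0-mod⇒ℕ-∣ (≡-mod-trans (≡-mod-reflexive (ℤ.pos-* q W)) (≡-mod-trans (*-congˡ-mod (+ q) W≡w) qw≡0))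
      n∣[1+W]^p∸1 : n ℕ∣.∣ (1 ℕ.+ W) ℕ.^ p ℕ.∸ 1
      n∣[1+W]^p∸1 = ≡0-mod⇒ℕ-∣ (begin
        + ((1 ℕ.+ W) ℕ.^ p ℕ.∸ 1)   ≡⟨ trans (ℤ.m-n≡m⊖n ((1 ℕ.+ W) ℕ.^ p) 1) (ℤ.⊖-≥ (ℕ.m^n>0 (1 ℕ.+ W) p)) ⟨
        + ((1 ℕ.+ W) ℕ.^ p) - 1ℤ    ≡⟨ cong (_- 1ℤ) (trans (pos-^ (1 ℕ.+ W) p) (cong (_^ p) (ℤ.pos-+ 1 W))) ⟩
        (1ℤ + + W) ^ p - 1ℤ         ≈⟨ +-congʳ-mod -1ℤ (^-cong-mod p (+-congˡ-mod 1ℤ W≡w)) ⟩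
        (1ℤ + w) ^ p - 1ℤ           ≈⟨ +-congʳ-mod -1ℤ [1+w]^p≡1 ⟩
        0ℤ                          ∎)
        where open ≡-mod-Reasoning n
      p^[1+k]M∣pW×W² = order-p-unit⇒square-zero {h = h} k pp p-odd p∤M
        (subst (ℕ∣._∣ q ℕ.* W) n≡ n∣qW) (subst (ℕ∣._∣ (1 ℕ.+ W) ℕ.^ p ℕ.∸ 1) n≡ n∣[1+W]^p∸1)

  *-geometric≡0⇒p*≡0 : ∀ {m p h w κ} → p ≡ ℕ.suc (2 ℕ.* h) → + p * w ≡ 0ℤ [mod m ] → w * w ≡ 0ℤ [mod m ]
    → κ * geometric (1ℤ + w) p ≡ 0ℤ [mod m ] → + p * κ ≡ 0ℤ [mod m ]
  *-geometric≡0⇒p*≡0 {p = p} {h} {κ = κ} p-odd pw≡0 w²≡0 κG≡0 = ≡-mod-trans (≡-mod-reflexive (ℤ.*-comm (+ p) κ))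
    (≡-mod-trans (*-congˡ-mod κ (≡-mod-sym (geometric-odd-order {h = h} p-odd pw≡0 w²≡0))) κG≡0)

module DihedralCoordinates (n : ℕ) .{{_ : NonZero n}} where

  open import Defs
  open ModularArithmetic
  import Data.Nat.Base as ℕ
  import Data.Nat.Properties as ℕ
  import Data.Nat.Divisibility as ℕ
  open import Data.Nat.DivMod using (_mod_; _%_; _/_; m≡m%n+[m/n]*n; m%n<n)
  open import Data.Integer.Base using (ℤ; +_; -_; _+_; _-_; _*_; 0ℤ; 1ℤ; -1ℤ; ∣_∣)
  import Data.Integer.Properties as ℤ
  open import Data.Integer.DivMod using (n%ℕd<d)
  open import Data.Integer.Divisibility.Signed using (∣⇒∣ᵤ)
  open import Data.Integer.Tactic.RingSolver using (solve-∀)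
  open import Data.Fin.Base using (Fin; toℕ; fromℕ<)
  open import Data.Fin.Properties using (toℕ-fromℕ<; toℕ-injective; toℕ<n)
  open import Data.Bool.Base using (Bool; true; false; not; _xor_)
  open import Data.Product using (_,_; proj₁; proj₂)
  open import Data.Sum using (inj₁; inj₂)
  open import Relation.Binary.PropositionalEquality
  open import Relation.Nullary using (contradiction)

  private
    ∣-below⇒≡0 : ∀ {d} → n ℕ.∣ d → d ℕ.< n → d ≡ 0
    ∣-below⇒≡0 {ℕ.zero}  _   _   = refl
    ∣-below⇒≡0 {ℕ.suc d} n∣d d<n = contradiction (ℕ.∣⇒≤ n∣d) (ℕ.<⇒≱ d<n)

    ≤-mod-unique : ∀ {a b} → a ℕ.≤ b → b ℕ.< n → + a ≡ + b [mod n ] → a ≡ b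
    ≤-mod-unique {a} {b} a≤b b<n (congruent n∣a-b) = ℕ.≤-antisym a≤b (ℕ.m∸n≡0⇒m≤n (∣-below⇒≡0 n∣b∸a b∸a<n))
      where
        n∣b∸a : n ℕ.∣ b ℕ.∸ a
        n∣b∸a = subst (n ℕ.∣_) (trans (cong ∣_∣ (ℤ.m-n≡m⊖n a b)) (ℤ.∣⊖∣-≤ a≤b)) (∣⇒∣ᵤ n∣a-b)
        b∸a<n : b ℕ.∸ a ℕ.< n
        b∸a<n = ℕ.≤-<-trans (ℕ.m∸n≤m b a) b<n

  mod-unique : ∀ {a b} → a ℕ.< n → b ℕ.< n → + a ≡ + b [mod n ] → a ≡ b
  mod-unique {a} {b} a<n b<n a≡b with ℕ.≤-total a b
  ... | inj₁ a≤b = ≤-mod-unique a≤b b<n a≡b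
  ... | inj₂ b≤a = sym (≤-mod-unique b≤a a<n (≡-mod-sym a≡b))

  toℤ : Fin n → ℤ
  toℤ i = + toℕ i

  opaque
    ℤ→Fin : ℤ → Fin n
    ℤ→Fin z = fromℕ< (n%ℕd<d z n)

    toℤ-ℤ→Fin : ∀ z → toℤ (ℤ→Fin z) ≡ z [mod n ]
    toℤ-ℤ→Fin z = subst (_≡ z [mod n ]) (cong +_ (sym (toℕ-fromℕ< (n%ℕd<d z n)))) (%ℕ-mod z n)

  ℤ→Fin-unique : ∀ i z → toℤ i ≡ z [mod n ] → i ≡ ℤ→Fin z
  ℤ→Fin-unique i z i≡z = toℕ-injective
    (mod-unique (toℕ<n i) (toℕ<n (ℤ→Fin z)) (≡-mod-trans i≡z (≡-mod-sym (toℤ-ℤ→Fin z))))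

  ℤ→Fin-toℤ : ∀ i → ℤ→Fin (toℤ i) ≡ i
  ℤ→Fin-toℤ i = sym (ℤ→Fin-unique i (toℤ i) ≡-mod-refl)

  ℤ→Fin-cong : ∀ {x y} → x ≡ y [mod n ] → ℤ→Fin x ≡ ℤ→Fin y
  ℤ→Fin-cong {x} {y} x≡y = ℤ→Fin-unique (ℤ→Fin x) y (≡-mod-trans (toℤ-ℤ→Fin x) x≡y)

  ℤ→Fin-injective : ∀ {x y} → ℤ→Fin x ≡ ℤ→Fin y → x ≡ y [mod n ]
  ℤ→Fin-injective {x} {y} eq =
    ≡-mod-trans (≡-mod-sym (toℤ-ℤ→Fin x)) (subst (λ i → toℤ i ≡ y [mod n ]) (sym eq) (toℤ-ℤ→Fin y))

  toℤ-mod : ∀ a → toℤ (a mod n) ≡ + a [mod n ]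
  toℤ-mod a = subst₂ (_≡_[mod n ]) (cong +_ (sym (toℕ-fromℕ< (m%n<n a n)))) (sym +a≡)
    (≡-mod-sym (+-multiple-mod (+ (a % n)) (+ (a / n))))
    where
      +a≡ : + a ≡ + (a % n) + + (a / n) * + n
      +a≡ = trans (cong +_ (m≡m%n+[m/n]*n a n))
                  (trans (ℤ.pos-+ (a % n) (a / n ℕ.* n)) (cong (λ t → + (a % n) + t) (ℤ.pos-* (a / n) n)))

  toℤ-addF : ∀ i j → toℤ (addF {n} i j) ≡ toℤ i + toℤ j [mod n ]
  toℤ-addF i j = ≡-mod-trans (toℤ-mod _) (≡-mod-reflexive (ℤ.pos-+ (toℕ i) (toℕ j)))

  toℤ-negF : ∀ i → toℤ (negF {n} i) ≡ - toℤ i [mod n ]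
  toℤ-negF i = ≡-mod-trans (toℤ-mod (n ℕ.∸ toℕ i))
    (subst (_≡ - toℤ i [mod n ]) n-i≡n∸i (≡-mod-trans (≡-mod-reflexive (reorder (+ n) (toℤ i))) (+-multiple-mod (- toℤ i) 1ℤ)))
    where
      n-i≡n∸i : + n - toℤ i ≡ + (n ℕ.∸ toℕ i)
      n-i≡n∸i = trans (ℤ.m-n≡m⊖n n (toℕ i)) (ℤ.⊖-≥ (ℕ.<⇒≤ (toℕ<n i)))
      reorder : ∀ N t → N - t ≡ - t + 1ℤ * N
      reorder = solve-∀

  infix 9 a^_b^_
  a^_b^_ : ℤ → Bool → D {n}
  a^ z b^ e = ℤ→Fin z , e

  a^b^-cong : ∀ {x y} e → x ≡ y [mod n ] → a^ x b^ e ≡ a^ y b^ e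
  a^b^-cong e x≡y = cong (_, e) (ℤ→Fin-cong x≡y)

  a^b^-injective : ∀ {x y e f} → a^ x b^ e ≡ a^ y b^ f → x ≡ y [mod n ]
  a^b^-injective eq = ℤ→Fin-injective (cong proj₁ eq)

  a^b^-coordinates : ∀ (d : D {n}) → d ≡ a^ toℤ (proj₁ d) b^ proj₂ d
  a^b^-coordinates (i , e) = cong (_, e) (sym (ℤ→Fin-toℤ i))

  sgn : Bool → ℤ
  sgn false = 1ℤ
  sgn true  = -1ℤ

  sgn-xor : ∀ e f → sgn (e xor f) ≡ sgn e * sgn f
  sgn-xor false false = refl
  sgn-xor false true  = refl
  sgn-xor true  false = refl
  sgn-xor true  true  = refl

  sgn*sgn : ∀ e → sgn e * sgn e ≡ 1ℤ
  sgn*sgn false = refl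
  sgn*sgn true  = refl

  ·-a^b^ : ∀ i e j f → a^ i b^ e · a^ j b^ f ≡ a^ (i + sgn e * j) b^ (e xor f)
  ·-a^b^ i false j f = cong (_, f) (ℤ→Fin-unique _ _
    (≡-mod-trans (toℤ-addF (ℤ→Fin i) (ℤ→Fin j))
      (+-cong-mod (toℤ-ℤ→Fin i) (≡-mod-trans (toℤ-ℤ→Fin j) (≡-mod-reflexive (sym (ℤ.*-identityˡ j)))))))
  ·-a^b^ i true j f = cong (_, not f) (ℤ→Fin-unique _ _
    (≡-mod-trans (toℤ-addF (ℤ→Fin i) (negF (ℤ→Fin j)))
      (+-cong-mod (toℤ-ℤ→Fin i)
        (≡-mod-trans (toℤ-negF (ℤ→Fin j)) (≡-mod-trans (-‿cong-mod (toℤ-ℤ→Fin j)) (≡-mod-reflexive (sym (ℤ.-1*i≡-i j))))))))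

  one≡a^0 : one {n} ≡ a^ 0ℤ b^ false
  one≡a^0 = cong (_, false) (ℤ→Fin-unique _ _ (toℤ-mod 0))

  aa≡a^1 : aa {n} ≡ a^ 1ℤ b^ false
  aa≡a^1 = cong (_, false) (ℤ→Fin-unique _ _ (toℤ-mod 1))

  bb≡a^0b : bb {n} ≡ a^ 0ℤ b^ true
  bb≡a^0b = cong (_, true) (ℤ→Fin-unique _ _ (toℤ-mod 0))

module DihedralAutomorphisms (n : ℕ) .{{_ : NonZero n}} where

  open import Defs
  open ModularArithmetic
  open DihedralCoordinates n
  import Data.Nat.Base as ℕ
  open import Data.Integer.Base using (ℤ; +_; -_; _+_; _-_; _*_; _^_; 0ℤ; 1ℤ; -1ℤ)
  import Data.Integer.Properties as ℤ
  open import Data.Integer.Tactic.RingSolver using (solve-∀)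
  open import Data.Fin.Base using (Fin; toℕ; zero; suc)
  open import Data.Fin.Properties using (suc-injective)
  open import Data.Bool.Base using (true; false; _xor_)
  open import Data.Product using (∃-syntax; _×_; _,_; proj₁; proj₂)
  open import Function using (_∘_)
  open import Relation.Binary.PropositionalEquality
  open ≡-Reasoning

  one-· : ∀ x → one {n} · x ≡ x
  one-· (i , e) = begin
    one · (i , e)                        ≡⟨ cong₂ _·_ one≡a^0 (a^b^-coordinates (i , e)) ⟩
    a^ 0ℤ b^ false · a^ toℤ i b^ e       ≡⟨ ·-a^b^ 0ℤ false (toℤ i) e ⟩
    a^ (0ℤ + 1ℤ * toℤ i) b^ e            ≡⟨ a^b^-cong e (≡-mod-reflexive (trans (ℤ.+-identityˡ _) (ℤ.*-identityˡ _))) ⟩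
    a^ toℤ i b^ e                        ≡⟨ a^b^-coordinates (i , e) ⟨
    (i , e)                              ∎

  ·-one : ∀ x → x · one {n} ≡ x
  ·-one (i , e) = begin
    (i , e) · one                        ≡⟨ cong₂ _·_ (a^b^-coordinates (i , e)) one≡a^0 ⟩
    a^ toℤ i b^ e · a^ 0ℤ b^ false       ≡⟨ ·-a^b^ (toℤ i) e 0ℤ false ⟩
    a^ (toℤ i + sgn e * 0ℤ) b^ (e xor false)
      ≡⟨ cong₂ a^_b^_ (trans (cong (λ t → toℤ i + t) (ℤ.*-zeroʳ (sgn e))) (ℤ.+-identityʳ _)) (xor-false e) ⟩
    a^ toℤ i b^ e                        ≡⟨ a^b^-coordinates (i , e) ⟨
    (i , e)                              ∎
    where
      xor-false : ∀ e → e xor false ≡ e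
      xor-false false = refl
      xor-false true  = refl

  rotation-· : ∀ x y f → a^ x b^ false · a^ y b^ f ≡ a^ (x + y) b^ f
  rotation-· x y f = trans (·-a^b^ x false y f) (a^b^-cong f (≡-mod-reflexive (cong (λ t → x + t) (ℤ.*-identityˡ y))))

  pow-rotation : ∀ x k → pow (a^ x b^ false) k ≡ a^ (+ k * x) b^ false
  pow-rotation x ℕ.zero    = trans one≡a^0 (a^b^-cong false (≡-mod-reflexive (sym (ℤ.*-zeroˡ x))))
  pow-rotation x (ℕ.suc k) = begin
    a^ x b^ false · pow (a^ x b^ false) k   ≡⟨ cong (a^ x b^ false ·_) (pow-rotation x k) ⟩
    a^ x b^ false · a^ (+ k * x) b^ false   ≡⟨ rotation-· x (+ k * x) false ⟩
    a^ (x + + k * x) b^ false               ≡⟨ a^b^-cong false (≡-mod-reflexive (trans (distrib x (+ k)) (cong (_* x) (sym (ℤ.pos-+ 1 k))))) ⟩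
    a^ (+ ℕ.suc k * x) b^ false             ∎
    where
      distrib : ∀ x k → x + k * x ≡ (1ℤ + k) * x
      distrib = solve-∀

  pow-aa : ∀ k → pow aa k ≡ a^ + k b^ false
  pow-aa k = trans (cong (λ g → pow g k) aa≡a^1) (trans (pow-rotation 1ℤ k) (a^b^-cong false (≡-mod-reflexive (ℤ.*-identityʳ (+ k)))))

  rotation≡pow-aa : ∀ z → a^ z b^ false ≡ pow aa (toℕ (ℤ→Fin z))
  rotation≡pow-aa z = sym (trans (pow-aa (toℕ (ℤ→Fin z))) (a^b^-cong false (toℤ-ℤ→Fin z)))

  idempotent⇒one : ∀ (d : D {n}) → d · d ≡ d → d ≡ one
  idempotent⇒one (i , true)  dd≡d with cong proj₂ dd≡d
  ... | ()
  idempotent⇒one (i , false) dd≡d = begin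
    (i , false)          ≡⟨ a^b^-coordinates (i , false) ⟩
    a^ t b^ false        ≡⟨ a^b^-cong false t≡0 ⟩
    a^ 0ℤ b^ false       ≡⟨ one≡a^0 ⟨
    one                  ∎
    where
      t = toℤ i
      t+t≡t : t + t ≡ t [mod n ]
      t+t≡t = a^b^-injective (begin
        a^ (t + t) b^ false                 ≡⟨ rotation-· t t false ⟨
        a^ t b^ false · a^ t b^ false       ≡⟨ cong₂ _·_ (a^b^-coordinates (i , false)) (a^b^-coordinates (i , false)) ⟨
        (i , false) · (i , false)           ≡⟨ dd≡d ⟩
        (i , false)                         ≡⟨ a^b^-coordinates (i , false) ⟩
        a^ t b^ false                       ∎)
      t≡0 : t ≡ 0ℤ [mod n ]
      t≡0 = ≡-mod-trans (≡-mod-reflexive (cancel t))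
              (≡-mod-trans (+-cong-mod t+t≡t (≡-mod-refl {x = - t})) (≡-mod-reflexive (ℤ.+-inverseʳ t)))
        where
          cancel : ∀ t → t ≡ t + t + - t
          cancel = solve-∀

  module _ (φ : AutD {n}) where

    aut-one : fun φ one ≡ one
    aut-one = idempotent⇒one (fun φ one) (begin
      fun φ one · fun φ one   ≡⟨ hom φ one one ⟨
      fun φ (one · one)       ≡⟨ cong (fun φ) (one-· one) ⟩
      fun φ one               ∎)

    aut-pow : ∀ g k → fun φ (pow g k) ≡ pow (fun φ g) k
    aut-pow g ℕ.zero    = aut-one
    aut-pow g (ℕ.suc k) = trans (hom φ g (pow g k)) (cong (fun φ g ·_) (aut-pow g k))

    aut-prodD : ∀ m g → fun φ (prodD m g) ≡ prodD m (fun φ ∘ g)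
    aut-prodD ℕ.zero    g = aut-one
    aut-prodD (ℕ.suc m) g = trans (hom φ _ _) (cong (fun φ (g zero) ·_) (aut-prodD m (g ∘ suc)))

  sumℤ : (m : ℕ) → (Fin m → ℤ) → ℤ
  sumℤ ℕ.zero    c = 0ℤ
  sumℤ (ℕ.suc m) c = c zero + sumℤ m (c ∘ suc)

  prodD-rotations : ∀ m (g : Fin m → D {n}) c → (∀ i → g i ≡ a^ c i b^ false) → prodD m g ≡ a^ sumℤ m c b^ false
  prodD-rotations ℕ.zero    g c _     = one≡a^0
  prodD-rotations (ℕ.suc m) g c g≡c =
    trans (cong₂ _·_ (g≡c zero) (prodD-rotations m (g ∘ suc) (c ∘ suc) (g≡c ∘ suc))) (rotation-· _ _ false)

  prodD-rotations-update : ∀ m (g : Fin m → D {n}) c t d → (∀ i → i ≢ t → g i ≡ a^ c i b^ false) → g t ≡ a^ d b^ false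
    → prodD m g ≡ a^ (sumℤ m c + (d - c t)) b^ false
  prodD-rotations-update (ℕ.suc m) g c zero d g≡c g[t]≡d =
    trans (cong₂ _·_ g[t]≡d (prodD-rotations m (g ∘ suc) (c ∘ suc) (λ i → g≡c (suc i) λ ())))
      (trans (rotation-· _ _ false) (a^b^-cong false (≡-mod-reflexive (regroup d (c zero) _))))
    where
      regroup : ∀ d c₀ s → d + s ≡ (c₀ + s) + (d - c₀)
      regroup = solve-∀
  prodD-rotations-update (ℕ.suc m) g c (suc t) d g≡c g[t]≡d =
    trans (cong₂ _·_ (g≡c zero λ ())
                     (prodD-rotations-update m (g ∘ suc) (c ∘ suc) t d (λ i i≢t → g≡c (suc i) (i≢t ∘ suc-injective)) g[t]≡d))
      (trans (rotation-· _ _ false) (a^b^-cong false (≡-mod-reflexive (sym (ℤ.+-assoc (c zero) _ _)))))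

  iter-θ-rotation : ∀ k z → iter thetaA k (a^ z b^ false) ≡ a^ z b^ false
  iter-θ-rotation ℕ.zero    z = refl
  iter-θ-rotation (ℕ.suc k) z = cong thetaA (iter-θ-rotation k z)

  θ-reflection : ∀ z → thetaA (a^ z b^ true) ≡ a^ (z - 1ℤ) b^ true
  θ-reflection z = begin
    a^ z b^ false · (bb · aa)                         ≡⟨ cong (λ g → a^ z b^ false · g) (cong₂ _·_ bb≡a^0b aa≡a^1) ⟩
    a^ z b^ false · (a^ 0ℤ b^ true · a^ 1ℤ b^ false)  ≡⟨ cong (a^ z b^ false ·_) (·-a^b^ 0ℤ true 1ℤ false) ⟩
    a^ z b^ false · a^ -1ℤ b^ true                    ≡⟨ rotation-· z -1ℤ true ⟩
    a^ (z - 1ℤ) b^ true                               ∎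

  iter-θ-reflection : ∀ k z → iter thetaA k (a^ z b^ true) ≡ a^ (z - + k) b^ true
  iter-θ-reflection ℕ.zero    z = a^b^-cong true (≡-mod-reflexive (sym (ℤ.+-identityʳ z)))
  iter-θ-reflection (ℕ.suc k) z = begin
    thetaA (iter thetaA k (a^ z b^ true))   ≡⟨ cong thetaA (iter-θ-reflection k z) ⟩
    thetaA (a^ (z - + k) b^ true)           ≡⟨ θ-reflection (z - + k) ⟩
    a^ (z - + k - 1ℤ) b^ true               ≡⟨ a^b^-cong true (≡-mod-reflexive (trans (regroup z (+ k)) (cong (λ t → z - t) (sym (ℤ.pos-+ 1 k))))) ⟩
    a^ (z - + ℕ.suc k) b^ true              ∎
    where
      regroup : ∀ z k → z - k - 1ℤ ≡ z - (1ℤ + k)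
      regroup = solve-∀

  -- Evaluating σ R(g) σ⁻¹ = R(h) at 1 gives h = σ g, and evaluating it at σ g then gives the claim.
  conjugation-square : ∀ (σ : Perm {n}) g h → pf σ one ≡ one → (∀ x → pf σ (pinv σ x · g) ≡ x · h)
    → pf σ (g · g) ≡ pf σ g · pf σ g
  conjugation-square σ g h σ1≡1 conj = begin
    pf σ (g · g)                     ≡⟨ cong (λ x → pf σ (x · g)) (pinv-pf σ g) ⟨
    pf σ (pinv σ (pf σ g) · g)       ≡⟨ conj (pf σ g) ⟩
    pf σ g · h                       ≡⟨ cong (pf σ g ·_) σg≡h ⟨
    pf σ g · pf σ g                  ∎
    where
      σ⁻¹1≡1 : pinv σ one ≡ one
      σ⁻¹1≡1 = trans (cong (pinv σ) (sym σ1≡1)) (pinv-pf σ one)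
      σg≡h : pf σ g ≡ h
      σg≡h = begin
        pf σ g                  ≡⟨ cong (pf σ) (one-· g) ⟨
        pf σ (one · g)          ≡⟨ cong (λ x → pf σ (x · g)) σ⁻¹1≡1 ⟨
        pf σ (pinv σ one · g)   ≡⟨ conj one ⟩
        one · h                 ≡⟨ one-· h ⟩
        h                       ∎

  module Affine (φ : AutD {n}) (v κ : ℤ) (φa≡a^v : fun φ aa ≡ a^ v b^ false) (φb≡a^κb : fun φ bb ≡ a^ κ b^ true) where

    affine-rotation : ∀ z → fun φ (a^ z b^ false) ≡ a^ (z * v) b^ false
    affine-rotation z = begin
      fun φ (a^ z b^ false)       ≡⟨ cong (fun φ) (rotation≡pow-aa z) ⟩
      fun φ (pow aa k)            ≡⟨ aut-pow φ aa k ⟩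
      pow (fun φ aa) k            ≡⟨ cong (λ g → pow g k) φa≡a^v ⟩
      pow (a^ v b^ false) k       ≡⟨ pow-rotation v k ⟩
      a^ (+ k * v) b^ false       ≡⟨ a^b^-cong false (*-cong-mod (toℤ-ℤ→Fin z) ≡-mod-refl) ⟩
      a^ (z * v) b^ false         ∎
      where k = toℕ (ℤ→Fin z)

    affine-reflection : ∀ z → fun φ (a^ z b^ true) ≡ a^ (z * v + κ) b^ true
    affine-reflection z = begin
      fun φ (a^ z b^ true)                         ≡⟨ cong (fun φ) reflection≡rotation·b ⟩
      fun φ (a^ z b^ false · bb)                   ≡⟨ hom φ _ _ ⟩
      fun φ (a^ z b^ false) · fun φ bb             ≡⟨ cong₂ _·_ (affine-rotation z) φb≡a^κb ⟩
      a^ (z * v) b^ false · a^ κ b^ true           ≡⟨ rotation-· (z * v) κ true ⟩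
      a^ (z * v + κ) b^ true                       ∎
      where
        reflection≡rotation·b : a^ z b^ true ≡ a^ z b^ false · bb
        reflection≡rotation·b = sym (trans (cong (a^ z b^ false ·_) bb≡a^0b)
          (trans (rotation-· z 0ℤ true) (a^b^-cong true (≡-mod-reflexive (ℤ.+-identityʳ z)))))

    iter-affine-rotation : ∀ j z → iter (fun φ) j (a^ z b^ false) ≡ a^ (z * v ^ j) b^ false
    iter-affine-rotation ℕ.zero    z = a^b^-cong false (≡-mod-reflexive (sym (ℤ.*-identityʳ z)))
    iter-affine-rotation (ℕ.suc j) z = begin
      fun φ (iter (fun φ) j (a^ z b^ false))   ≡⟨ cong (fun φ) (iter-affine-rotation j z) ⟩
      fun φ (a^ (z * v ^ j) b^ false)          ≡⟨ affine-rotation (z * v ^ j) ⟩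
      a^ (z * v ^ j * v) b^ false              ≡⟨ a^b^-cong false (≡-mod-reflexive (regroup z (v ^ j) v)) ⟩
      a^ (z * (v * v ^ j)) b^ false            ∎
      where
        regroup : ∀ z w v → z * w * v ≡ z * (v * w)
        regroup = solve-∀

    iter-affine-b : ∀ j → iter (fun φ) j bb ≡ a^ (κ * geometric v j) b^ true
    iter-affine-b ℕ.zero    = trans bb≡a^0b (a^b^-cong true (≡-mod-reflexive (sym (ℤ.*-zeroʳ κ))))
    iter-affine-b (ℕ.suc j) = begin
      fun φ (iter (fun φ) j bb)                      ≡⟨ cong (fun φ) (iter-affine-b j) ⟩
      fun φ (a^ (κ * geometric v j) b^ true)         ≡⟨ affine-reflection (κ * geometric v j) ⟩
      a^ (κ * geometric v j * v + κ) b^ true         ≡⟨ a^b^-cong true (≡-mod-reflexive (regroup κ (geometric v j) v)) ⟩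
      a^ (κ * (1ℤ + v * geometric v j)) b^ true      ∎
      where
        regroup : ∀ κ g v → κ * g * v + κ ≡ κ * (1ℤ + v * g)
        regroup = solve-∀

    affine-order : ∀ q → (∀ x → iter (fun φ) q x ≡ x) → v ^ q ≡ 1ℤ [mod n ] × κ * geometric v q ≡ 0ℤ [mod n ]
    affine-order q φ^q≡id = vᵠ≡1 , κGq≡0
      where
        vᵠ≡1 : v ^ q ≡ 1ℤ [mod n ]
        vᵠ≡1 = ≡-mod-trans (≡-mod-reflexive (sym (ℤ.*-identityˡ (v ^ q)))) (a^b^-injective (begin
          a^ (1ℤ * v ^ q) b^ false                  ≡⟨ iter-affine-rotation q 1ℤ ⟨
          iter (fun φ) q (a^ 1ℤ b^ false)           ≡⟨ φ^q≡id (a^ 1ℤ b^ false) ⟩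
          a^ 1ℤ b^ false                            ∎))
        κGq≡0 : κ * geometric v q ≡ 0ℤ [mod n ]
        κGq≡0 = a^b^-injective (begin
          a^ (κ * geometric v q) b^ true            ≡⟨ iter-affine-b q ⟨
          iter (fun φ) q bb                         ≡⟨ φ^q≡id bb ⟩
          bb                                        ≡⟨ bb≡a^0b ⟩
          a^ 0ℤ b^ true                             ∎)

    affine-θ-power : ∀ k → v ≡ 1ℤ [mod n ] → κ ≡ - + k → InThetaA φ
    affine-θ-power k v≡1 refl = k , λ x → subst (λ x → fun φ x ≡ iter thetaA k x) (sym (a^b^-coordinates x))
                                            (by-cases (toℤ (proj₁ x)) (proj₂ x))
      where
        zv≡z : ∀ z → z * v ≡ z [mod n ]
        zv≡z z = ≡-mod-trans (*-congˡ-mod z v≡1) (≡-mod-reflexive (ℤ.*-identityʳ z))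
        by-cases : ∀ z e → fun φ (a^ z b^ e) ≡ iter thetaA k (a^ z b^ e)
        by-cases z false = trans (affine-rotation z) (trans (a^b^-cong false (zv≡z z)) (sym (iter-θ-rotation k z)))
        by-cases z true  = trans (affine-reflection z) (trans (a^b^-cong true (+-congʳ-mod κ (zv≡z z))) (sym (iter-θ-reflection k z)))

  semidirect-affine : ∀ (α β : AutD {n}) k v → (∀ x → fun α x ≡ iter thetaA k (fun β x))
    → fun β aa ≡ a^ v b^ false → fun β bb ≡ bb → fun α aa ≡ a^ v b^ false × fun α bb ≡ a^ (- + k) b^ true
  semidirect-affine α β k v α≡θᵏβ βa≡a^v βb≡b =
    trans (α≡θᵏβ aa) (trans (cong (iter thetaA k) βa≡a^v) (iter-θ-rotation k v)) ,
    trans (α≡θᵏβ bb) (trans (cong (iter thetaA k) (trans βb≡b bb≡a^0b))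
      (trans (iter-θ-reflection k 0ℤ) (a^b^-cong true (≡-mod-reflexive (ℤ.+-identityˡ (- + k))))))

  -- If a_t = a^c and β a_t = a_t^u, then w = (u - 1) c.
  autC-on-a : ∀ m (as : Fin m → D {n}) t (β : AutD {n}) q → (∀ i → InCyclic aa (as i)) → prodD m as ≡ aa
    → pow (as t) q ≡ one → InAutC m as t β → ∃[ w ] fun β aa ≡ a^ (1ℤ + w) b^ false × (+ q * w ≡ 0ℤ [mod n ])
  autC-on-a m as t β q as∈⟨a⟩ ∏as≡a as[t]^q≡1 (_ , β-fixes , β-preserves) = w , βa≡a^[1+w] , qw≡0
    where
      c : Fin m → ℤ
      c i = + proj₁ (as∈⟨a⟩ i)
      as≡a^c : ∀ i → as i ≡ a^ c i b^ false
      as≡a^c i = trans (proj₂ (as∈⟨a⟩ i)) (pow-aa _)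
      βa[t]∈⟨a[t]⟩ = β-preserves (as t) (1 , sym (·-one (as t)))
      u = proj₁ βa[t]∈⟨a[t]⟩
      βa[t]≡a^[uc] : fun β (as t) ≡ a^ (+ u * c t) b^ false
      βa[t]≡a^[uc] = trans (proj₂ βa[t]∈⟨a[t]⟩) (trans (cong (λ g → pow g u) (as≡a^c t)) (pow-rotation (c t) u))
      w = + u * c t - c t
      Σc≡1 : sumℤ m c ≡ 1ℤ [mod n ]
      Σc≡1 = a^b^-injective (trans (sym (prodD-rotations m as c as≡a^c)) (trans ∏as≡a aa≡a^1))
      βa≡a^[1+w] : fun β aa ≡ a^ (1ℤ + w) b^ false
      βa≡a^[1+w] = begin
        fun β aa                               ≡⟨ cong (fun β) ∏as≡a ⟨
        fun β (prodD m as)                     ≡⟨ aut-prodD β m as ⟩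
        prodD m (fun β ∘ as)
          ≡⟨ prodD-rotations-update m _ c t (+ u * c t) (λ i i≢t → trans (β-fixes i i≢t) (as≡a^c i)) βa[t]≡a^[uc] ⟩
        a^ (sumℤ m c + w) b^ false             ≡⟨ a^b^-cong false (+-congʳ-mod w Σc≡1) ⟩
        a^ (1ℤ + w) b^ false                   ∎
      qc≡0 : + q * c t ≡ 0ℤ [mod n ]
      qc≡0 = a^b^-injective (trans (sym (pow-rotation (c t) q)) (trans (cong (λ g → pow g q) (sym (as≡a^c t))) (trans as[t]^q≡1 one≡a^0)))
      qw≡0 : + q * w ≡ 0ℤ [mod n ]
      qw≡0 = ≡-mod-trans (≡-mod-reflexive (factor (+ q) (+ u) (c t)))
               (≡-mod-trans (*-congˡ-mod (+ u - 1ℤ) qc≡0) (≡-mod-reflexive (ℤ.*-zeroʳ (+ u - 1ℤ))))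
        where
          factor : ∀ q u c → q * (u * c - c) ≡ (u - 1ℤ) * (q * c)
          factor = solve-∀

import Data.Nat.Base as ℕ
open import Data.Nat.Primality using (Prime)
open import Data.Integer.Base using (ℤ; +_; _*_; 0ℤ)
open import Relation.Binary.PropositionalEquality using (_≡_)
open import Relation.Nullary using (¬_)
open ModularArithmetic using (_≡_[mod_])

module CayleyAutomorphism (n : ℕ) .{{_ : NonZero n}} {p h : ℕ} (prime : Prime p) (p-odd : p ≡ ℕ.suc (2 ℕ.* h))
  (w L : ℤ) (w≢0 : ¬ w ≡ 0ℤ [mod n ]) (w²≡0 : w * w ≡ 0ℤ [mod n ]) (pw≡0 : + p * w ≡ 0ℤ [mod n ]) where

  open import Defs
  open ModularArithmetic
  open DihedralCoordinates n
  open DihedralAutomorphisms n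
  open import Data.Integer.Base using (-_; _+_; _-_; 1ℤ; -1ℤ)
  import Data.Integer.Properties as ℤ
  open import Data.Integer.Tactic.RingSolver using (solve-∀)
  open import Data.Bool.Base using (Bool; true; false; _xor_)
  open import Data.Product using (∃-syntax; _,_; proj₁; proj₂)
  open import Relation.Binary.PropositionalEquality
  open import Relation.Nullary using (Dec; yes; no; contradiction)

  -- The automorphism α of the theorem satisfies α x = a^(ε x · w) x, where ε is a crossed homomorphism.
  ε : ℤ → Bool → ℤ
  ε z false = z
  ε z true  = z + L

  -- μ y = ε (y a⁻¹), so μ y · w = 0 says that y a⁻¹ is fixed by α.
  μ : ℤ → Bool → ℤ
  μ j false = j - 1ℤ
  μ j true  = j + 1ℤ + L

  ε-+ : ∀ z d e → ε (z + d) e ≡ ε z e + d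
  ε-+ z d false = refl
  ε-+ z d true  = lemma z d L
    where
      lemma : ∀ z d l → z + d + l ≡ z + l + d
      lemma = solve-∀

  μ-+ : ∀ z d f → μ (z + d) f ≡ μ z f + d
  μ-+ z d false = lemma z d
    where
      lemma : ∀ z d → z + d - 1ℤ ≡ z - 1ℤ + d
      lemma = solve-∀
  μ-+ z d true  = lemma z d L
    where
      lemma : ∀ z d l → z + d + 1ℤ + l ≡ z + 1ℤ + l + d
      lemma = solve-∀

  μ-· : ∀ i e j f → μ (i + sgn e * j) (e xor f) ≡ ε i e + sgn e * μ j f
  μ-· i false j false = lemma i j
    where
      lemma : ∀ i j → i + 1ℤ * j - 1ℤ ≡ i + 1ℤ * (j - 1ℤ)
      lemma = solve-∀
  μ-· i false j true  = lemma i j L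
    where
      lemma : ∀ i j l → i + 1ℤ * j + 1ℤ + l ≡ i + 1ℤ * (j + 1ℤ + l)
      lemma = solve-∀
  μ-· i true  j false = lemma i j L
    where
      lemma : ∀ i j l → i + -1ℤ * j + 1ℤ + l ≡ i + l + -1ℤ * (j - 1ℤ)
      lemma = solve-∀
  μ-· i true  j true  = lemma i j L
    where
      lemma : ∀ i j l → i + -1ℤ * j - 1ℤ ≡ i + l + -1ℤ * (j + 1ℤ + l)
      lemma = solve-∀

  μw-cong : ∀ f {x y} → x ≡ y [mod n ] → μ x f * w ≡ μ y f * w [mod n ]
  μw-cong false x≡y = *-congʳ-mod w (+-congʳ-mod -1ℤ x≡y)
  μw-cong true  x≡y = *-congʳ-mod w (+-congʳ-mod L (+-congʳ-mod 1ℤ x≡y))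

  μw-+-w-multiple : ∀ z d f → μ (z + d * w) f * w ≡ μ z f * w [mod n ]
  μw-+-w-multiple z d f = ≡-mod-trans (≡-mod-reflexive (trans (cong (_* w) (μ-+ z (d * w) f)) (expand (μ z f) d w)))
                            (+-absorb-mod (μ z f * w) d w²≡0)
    where
      expand : ∀ m d w → (m + d * w) * w ≡ m * w + d * (w * w)
      expand = solve-∀

  -- σ c multiplies Y = {y | μ y · w = 0} = Fix(α) · a on the right by a^(c w) and fixes everything else.
  σ : ℤ → D {n} → D {n}
  σ c (i , f) with μ (toℤ i) f * w ≡? 0ℤ [mod n ]
  ... | yes _ = a^ (toℤ i + sgn f * c * w) b^ f
  ... | no  _ = i , f

  σ-moves : ∀ c z f → μ z f * w ≡ 0ℤ [mod n ] → σ c (a^ z b^ f) ≡ a^ (z + sgn f * c * w) b^ f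
  σ-moves c z f μw≡0 with μ (toℤ (ℤ→Fin z)) f * w ≡? 0ℤ [mod n ]
  ... | yes _    = a^b^-cong f (+-congʳ-mod (sgn f * c * w) (toℤ-ℤ→Fin z))
  ... | no μw≢0 = contradiction (≡-mod-trans (μw-cong f (toℤ-ℤ→Fin z)) μw≡0) μw≢0

  σ-fixes : ∀ c z f → ¬ μ z f * w ≡ 0ℤ [mod n ] → σ c (a^ z b^ f) ≡ a^ z b^ f
  σ-fixes c z f μw≢0 with μ (toℤ (ℤ→Fin z)) f * w ≡? 0ℤ [mod n ]
  ... | yes μw≡0 = contradiction (≡-mod-trans (≡-mod-sym (μw-cong f (toℤ-ℤ→Fin z))) μw≡0) μw≢0
  ... | no  _    = refl

  σ-inverse : ∀ c d → σ c (σ (- c) d) ≡ d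
  σ-inverse c d = subst (λ d → σ c (σ (- c) d) ≡ d) (sym (a^b^-coordinates d))
                    (by-cases (toℤ (proj₁ d)) (proj₂ d) (μ (toℤ (proj₁ d)) (proj₂ d) * w ≡? 0ℤ [mod n ]))
    where
      by-cases : ∀ z f → Dec (μ z f * w ≡ 0ℤ [mod n ]) → σ c (σ (- c) (a^ z b^ f)) ≡ a^ z b^ f
      by-cases z f (yes μw≡0) = begin
        σ c (σ (- c) (a^ z b^ f))                           ≡⟨ cong (σ c) (σ-moves (- c) z f μw≡0) ⟩
        σ c (a^ (z + sgn f * - c * w) b^ f)                 ≡⟨ σ-moves c _ f (≡-mod-trans (μw-+-w-multiple z (sgn f * - c) f) μw≡0) ⟩
        a^ (z + sgn f * - c * w + sgn f * c * w) b^ f       ≡⟨ a^b^-cong f (≡-mod-reflexive (cancel z (sgn f) c w)) ⟩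
        a^ z b^ f                                           ∎
        where
          open ≡-Reasoning
          cancel : ∀ z s c w → z + s * - c * w + s * c * w ≡ z
          cancel = solve-∀
      by-cases z f (no μw≢0) = trans (cong (σ c) (σ-fixes (- c) z f μw≢0)) (σ-fixes c z f μw≢0)

  affine-normal-form : ∀ (α : AutD {n}) κ → fun α aa ≡ a^ (1ℤ + w) b^ false → fun α bb ≡ a^ κ b^ true
    → κ ≡ L * w [mod n ] → ∀ z e → fun α (a^ z b^ e) ≡ a^ (z + ε z e * w) b^ e
  affine-normal-form α κ αa≡ αb≡ κ≡Lw z false =
    trans (affine-rotation z) (a^b^-cong false (≡-mod-reflexive (distrib z w)))
    where
      open Affine α (1ℤ + w) κ αa≡ αb≡
      distrib : ∀ z w → z * (1ℤ + w) ≡ z + z * w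
      distrib = solve-∀
  affine-normal-form α κ αa≡ αb≡ κ≡Lw z true  =
    trans (affine-reflection z) (a^b^-cong true (≡-mod-trans (+-congˡ-mod (z * (1ℤ + w)) κ≡Lw) (≡-mod-reflexive (distrib z w L))))
    where
      open Affine α (1ℤ + w) κ αa≡ αb≡
      distrib : ∀ z w l → z * (1ℤ + w) + l * w ≡ z + (z + l) * w
      distrib = solve-∀

  module _ (α : D {n} → D {n}) (α-normal : ∀ z e → α (a^ z b^ e) ≡ a^ (z + ε z e * w) b^ e)
           (S : D {n} → Set) (S-closed : ∀ x → S x → S (α x)) where

    iter-α : ∀ k z e → iter α k (a^ z b^ e) ≡ a^ (z + + k * ε z e * w) b^ e
    iter-α ℕ.zero    z e = a^b^-cong e (≡-mod-reflexive (no-steps z (ε z e) w))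
      where
        no-steps : ∀ z E w → z ≡ z + 0ℤ * E * w
        no-steps = solve-∀
    iter-α (ℕ.suc k) z e = begin
      α (iter α k (a^ z b^ e))                    ≡⟨ cong α (iter-α k z e) ⟩
      α (a^ (z + K * E * w) b^ e)                  ≡⟨ α-normal (z + K * E * w) e ⟩
      a^ (z + K * E * w + ε (z + K * E * w) e * w) b^ e
        ≡⟨ a^b^-cong e (≡-mod-trans (≡-mod-reflexive eq) (+-absorb-mod (z + + ℕ.suc k * E * w) (K * E) w²≡0)) ⟩
      a^ (z + + ℕ.suc k * E * w) b^ e              ∎
      where
        open ≡-Reasoning
        K = + k
        E = ε z e
        expand : ∀ z K E w → z + K * E * w + (E + K * E * w) * w ≡ z + (1ℤ + K) * E * w + K * E * (w * w)
        expand = solve-∀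
        eq : z + K * E * w + ε (z + K * E * w) e * w ≡ z + + ℕ.suc k * E * w + K * E * (w * w)
        eq = trans (cong (λ t → z + K * E * w + t * w) (ε-+ z (K * E * w) e))
               (trans (expand z K E w) (cong (λ t → z + t * E * w + K * E * (w * w)) (sym (ℤ.pos-+ 1 k))))

    iter-closed : ∀ k x → S x → S (iter α k x)
    iter-closed ℕ.zero    x Sx = Sx
    iter-closed (ℕ.suc k) x Sx = S-closed _ (iter-closed k x Sx)

    -- ε x · w has order p, like w, so it generates the same multiples.
    orbit : ∀ {i e} → S (a^ i b^ e) → ¬ ε i e * w ≡ 0ℤ [mod n ] → ∀ t → S (a^ (i + t * w) b^ e)
    orbit {i} {e} Sx εw≢0 t = reach (solve-mod-prime prime ε≢0 t)
      where
        ε≢0 : ¬ ε i e ≡ 0ℤ [mod p ]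
        ε≢0 ε≡0 = εw≢0 (≡-mod-trans (*-congʳ-mod-torsion pw≡0 ε≡0) (≡-mod-reflexive (ℤ.*-zeroˡ w)))
        reach : ∃[ k ] + k * ε i e ≡ t [mod p ] → S (a^ (i + t * w) b^ e)
        reach (k , kε≡t) = subst S αᵏx≡ (iter-closed k (a^ i b^ e) Sx)
          where
            αᵏx≡ : iter α k (a^ i b^ e) ≡ a^ (i + t * w) b^ e
            αᵏx≡ = trans (iter-α k i e) (a^b^-cong e (+-congˡ-mod i (*-congʳ-mod-torsion pw≡0 kε≡t)))

    μw-· : ∀ i e j f → μ (i + sgn e * j) (e xor f) * w ≡ ε i e * w + sgn e * (μ j f * w)
    μw-· i e j f = trans (cong (_* w) (μ-· i e j f)) (distrib (ε i e) (sgn e) (μ j f) w)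
      where
        distrib : ∀ a s m w → (a + s * m) * w ≡ a * w + s * (m * w)
        distrib = solve-∀

    σ-arc-a^b^ : ∀ c i e j f → S (a^ i b^ e) → Arc S (σ c (a^ j b^ f)) (σ c (a^ (i + sgn e * j) b^ (e xor f)))
    σ-arc-a^b^ c i e j f Sx = by-cases (μ j f * w ≡? 0ℤ [mod n ]) (μ (i + sgn e * j) (e xor f) * w ≡? 0ℤ [mod n ])
      where
        open ≡-Reasoning
        g = e xor f
        y′ = i + sgn e * j
        by-cases : Dec (μ j f * w ≡ 0ℤ [mod n ]) → Dec (μ y′ g * w ≡ 0ℤ [mod n ])
                 → Arc S (σ c (a^ j b^ f)) (σ c (a^ y′ b^ g))
        by-cases (yes y∈Y) (yes xy∈Y) = a^ i b^ e , Sx , (begin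
          σ c (a^ y′ b^ g)                               ≡⟨ σ-moves c y′ g xy∈Y ⟩
          a^ (y′ + sgn g * c * w) b^ g                   ≡⟨ a^b^-cong g (≡-mod-reflexive (trans (cong (λ s → y′ + s * c * w) (sgn-xor e f))
                                                                                              (regroup i j (sgn e) (sgn f) c w))) ⟩
          a^ (i + sgn e * (j + sgn f * c * w)) b^ g      ≡⟨ ·-a^b^ i e (j + sgn f * c * w) f ⟨
          a^ i b^ e · a^ (j + sgn f * c * w) b^ f        ≡⟨ cong (a^ i b^ e ·_) (σ-moves c j f y∈Y) ⟨
          a^ i b^ e · σ c (a^ j b^ f)                    ∎)
          where
            regroup : ∀ i j s t c w → i + s * j + s * t * c * w ≡ i + s * (j + t * c * w)
            regroup = solve-∀
        by-cases (no y∉Y) (no xy∉Y) = a^ i b^ e , Sx , (begin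
          σ c (a^ y′ b^ g)                               ≡⟨ σ-fixes c y′ g xy∉Y ⟩
          a^ y′ b^ g                                     ≡⟨ ·-a^b^ i e j f ⟨
          a^ i b^ e · a^ j b^ f                          ≡⟨ cong (a^ i b^ e ·_) (σ-fixes c j f y∉Y) ⟨
          a^ i b^ e · σ c (a^ j b^ f)                    ∎)
        by-cases (yes y∈Y) (no xy∉Y) = a^ (i + t * w) b^ e , orbit Sx εw≢0 t , (begin
          σ c (a^ y′ b^ g)                               ≡⟨ σ-fixes c y′ g xy∉Y ⟩
          a^ y′ b^ g                                     ≡⟨ a^b^-cong g (≡-mod-reflexive (regroup i j (sgn e) (sgn f) c w)) ⟩
          a^ (i + t * w + sgn e * (j + sgn f * c * w)) b^ g ≡⟨ ·-a^b^ (i + t * w) e (j + sgn f * c * w) f ⟨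
          a^ (i + t * w) b^ e · a^ (j + sgn f * c * w) b^ f ≡⟨ cong (a^ (i + t * w) b^ e ·_) (σ-moves c j f y∈Y) ⟨
          a^ (i + t * w) b^ e · σ c (a^ j b^ f)          ∎)
          where
            t = - (sgn e * sgn f * c)
            regroup : ∀ i j s t c w → i + s * j ≡ i + - (s * t * c) * w + s * (j + t * c * w)
            regroup = solve-∀
            εw≢0 : ¬ ε i e * w ≡ 0ℤ [mod n ]
            εw≢0 εw≡0 = xy∉Y (≡-mod-trans (≡-mod-reflexive (μw-· i e j f))
              (≡-mod-trans (+-absorb-mod (ε i e * w) (sgn e) y∈Y) εw≡0))
        by-cases (no y∉Y) (yes xy∈Y) = a^ (i + t * w) b^ e , orbit Sx εw≢0 t , (begin
          σ c (a^ y′ b^ g)                               ≡⟨ σ-moves c y′ g xy∈Y ⟩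
          a^ (y′ + sgn g * c * w) b^ g                   ≡⟨ a^b^-cong g (≡-mod-reflexive (trans (cong (λ s → y′ + s * c * w) (sgn-xor e f))
                                                                                              (regroup i j (sgn e) (sgn f) c w))) ⟩
          a^ (i + t * w + sgn e * j) b^ g                ≡⟨ ·-a^b^ (i + t * w) e j f ⟨
          a^ (i + t * w) b^ e · a^ j b^ f                ≡⟨ cong (a^ (i + t * w) b^ e ·_) (σ-fixes c j f y∉Y) ⟨
          a^ (i + t * w) b^ e · σ c (a^ j b^ f)          ∎)
          where
            t = sgn e * sgn f * c
            regroup : ∀ i j s t c w → i + s * j + s * t * c * w ≡ i + s * t * c * w + s * j
            regroup = solve-∀
            μw≡ : μ j f * w ≡ sgn e * (μ y′ g * w - ε i e * w)
            μw≡ = sym (begin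
              sgn e * (μ y′ g * w - ε i e * w)                         ≡⟨ cong (λ m → sgn e * (m - ε i e * w)) (μw-· i e j f) ⟩
              sgn e * (ε i e * w + sgn e * (μ j f * w) - ε i e * w)    ≡⟨ cancel (ε i e * w) (sgn e) (μ j f * w) ⟩
              sgn e * sgn e * (μ j f * w)                              ≡⟨ cong (_* (μ j f * w)) (sgn*sgn e) ⟩
              1ℤ * (μ j f * w)                                         ≡⟨ ℤ.*-identityˡ (μ j f * w) ⟩
              μ j f * w                                                ∎)
              where
                cancel : ∀ a s m → s * (a + s * m - a) ≡ s * s * m
                cancel = solve-∀
            εw≢0 : ¬ ε i e * w ≡ 0ℤ [mod n ]
            εw≢0 εw≡0 = y∉Y (≡-mod-trans (≡-mod-reflexive μw≡)
              (≡-mod-trans (*-congˡ-mod (sgn e) (+-cong-mod xy∈Y (-‿cong-mod εw≡0))) (≡-mod-reflexive (ℤ.*-zeroʳ (sgn e)))))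

    σ-arc : ∀ c x y → Arc S x y → Arc S (σ c x) (σ c y)
    σ-arc c x y (s , Ss , y≡s·x) = subst₂ (λ u v → Arc S (σ c u) (σ c v)) (sym x≡) (sym y≡)
                                     (σ-arc-a^b^ c i e j f (subst S s≡ Ss))
      where
        i = toℤ (proj₁ s)
        e = proj₂ s
        j = toℤ (proj₁ x)
        f = proj₂ x
        s≡ = a^b^-coordinates s
        x≡ = a^b^-coordinates x
        y≡ : y ≡ a^ (i + sgn e * j) b^ (e xor f)
        y≡ = trans y≡s·x (trans (cong₂ _·_ s≡ x≡) (·-a^b^ i e j f))

    σ-perm : Perm {n}
    σ-perm = record { pf = σ 1ℤ ; pinv = σ -1ℤ ; pf-pinv = σ-inverse 1ℤ ; pinv-pf = σ-inverse -1ℤ }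

    σ-cayley-aut : IsCayAut S σ-perm
    σ-cayley-aut x y = σ-arc 1ℤ x y , λ arc → subst₂ (Arc S) (σ-inverse -1ℤ x) (σ-inverse -1ℤ y) (σ-arc -1ℤ _ _ arc)

    -- σ fixes 1 and a² but moves a, so normality would give σ (a a) = σ a · σ a, i.e. 2 w = 0.
    not-normal : ¬ IsNormalCay S
    not-normal normal = w≢0 w≡0
      where
        open ≡-Reasoning
        conj = normal σ-perm σ-cayley-aut aa
        w′ = 1ℤ * 1ℤ * w
        σ1≡1 : σ 1ℤ one ≡ one
        σ1≡1 = begin
          σ 1ℤ one                   ≡⟨ cong (σ 1ℤ) one≡a^0 ⟩
          σ 1ℤ (a^ 0ℤ b^ false)      ≡⟨ σ-fixes 1ℤ 0ℤ false 1∉Y ⟩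
          a^ 0ℤ b^ false             ≡⟨ one≡a^0 ⟨
          one                        ∎
          where
            1∉Y : ¬ -1ℤ * w ≡ 0ℤ [mod n ]
            1∉Y -w≡0 = w≢0 (≡-mod-trans (≡-mod-reflexive (negate w)) (-‿cong-mod -w≡0))
              where
                negate : ∀ w → w ≡ - (-1ℤ * w)
                negate = solve-∀
        σa≡a^[1+w] : σ 1ℤ aa ≡ a^ (1ℤ + w′) b^ false
        σa≡a^[1+w] = trans (cong (σ 1ℤ) aa≡a^1) (σ-moves 1ℤ 1ℤ false (≡-mod-reflexive (ℤ.*-zeroˡ w)))
        σaa≡aa : σ 1ℤ (aa · aa) ≡ a^ (1ℤ + 1ℤ) b^ false
        σaa≡aa = trans (cong (σ 1ℤ) (trans (cong₂ _·_ aa≡a^1 aa≡a^1) (rotation-· 1ℤ 1ℤ false)))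
                       (σ-fixes 1ℤ (1ℤ + 1ℤ) false (λ w≡0 → w≢0 (≡-mod-trans (≡-mod-reflexive (sym (ℤ.*-identityˡ w))) w≡0)))
        2≡2+2w : 1ℤ + 1ℤ ≡ 1ℤ + w′ + (1ℤ + w′) [mod n ]
        2≡2+2w = a^b^-injective (begin
          a^ (1ℤ + 1ℤ) b^ false                           ≡⟨ σaa≡aa ⟨
          σ 1ℤ (aa · aa)                                  ≡⟨ conjugation-square σ-perm aa (proj₁ conj) σ1≡1 (proj₂ conj) ⟩
          σ 1ℤ aa · σ 1ℤ aa                               ≡⟨ cong₂ _·_ σa≡a^[1+w] σa≡a^[1+w] ⟩
          a^ (1ℤ + w′) b^ false · a^ (1ℤ + w′) b^ false   ≡⟨ rotation-· (1ℤ + w′) (1ℤ + w′) false ⟩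
          a^ (1ℤ + w′ + (1ℤ + w′)) b^ false               ∎)
        2w≡0 : w + w ≡ 0ℤ [mod n ]
        2w≡0 = ≡-mod-trans (≡-mod-reflexive (difference w))
                 (≡-mod-trans (+-congʳ-mod (- (1ℤ + 1ℤ)) (≡-mod-sym 2≡2+2w)) (≡-mod-reflexive (ℤ.+-inverseʳ (1ℤ + 1ℤ))))
          where
            difference : ∀ w → w + w ≡ 1ℤ + 1ℤ * 1ℤ * w + (1ℤ + 1ℤ * 1ℤ * w) + - (1ℤ + 1ℤ)
            difference = solve-∀
        w≡0 : w ≡ 0ℤ [mod n ]
        w≡0 = ≡-mod-trans (≡-mod-reflexive (trans (odd-combination (+ h) w) (cong (λ q → q * w + - + h * (w + w)) +p≡1+2h)))
                (≡-mod-trans (+-absorb-mod (+ p * w) (- + h) 2w≡0) pw≡0)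
          where
            +p≡1+2h : 1ℤ + + 2 * + h ≡ + p
            +p≡1+2h = trans (cong (λ t → 1ℤ + t) (sym (ℤ.pos-* 2 h))) (trans (sym (ℤ.pos-+ 1 (2 ℕ.* h))) (cong +_ (sym p-odd)))
            odd-combination : ∀ h w → w ≡ (1ℤ + + 2 * h) * w + - h * (w + w)
            odd-combination = solve-∀

open import Defs
open import Data.Nat.Base using (_^_; _≤_)
open import Data.Nat.Divisibility using (_∣_)
open import Data.Fin.Base using (Fin)
open import Data.Integer.Base using (-_; _+_; 1ℤ)
open import Data.Product using (_,_; proj₁; proj₂)
open import Relation.Binary.PropositionalEquality using (refl; trans)
open ModularArithmetic
open NumberTheory

lemma4p1 : (n : ℕ) .{{_ : NonZero n}} → 2 ≤ n
    → (m : ℕ) (p r : Fin m → ℕ)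
    → (∀ i → Prime (p i)) → (∀ i j → p i ≡ p j → i ≡ j) → (∀ i → 1 ≤ r i)
    → n ≡ prodℕ m (λ i → p i ^ r i)
    → (as : Fin m → D {n})
    → (∀ i → InCyclic aa (as i))
    → (∀ i → HasOrder (as i) (p i ^ r i))
    → prodD m as ≡ aa
    → (S : D {n} → Set) → ¬ S one
    → (t : Fin m) → ¬ (2 ∣ p t)
    → (α : AutD {n})
    → FixesSet S α
    → AutHasOrder α (p t)
    → InSemi m as t α
    → ¬ InThetaA α
    → ¬ IsNormalCay S
lemma4p1 n _ m p r prime distinct r≥1 n≡∏ as as∈⟨a⟩ o[as] ∏as≡a S _ t 2∤p α α-fixes-S o[α]
         (k , β , β∈Aut[Cₜ] , α≡θᵏβ) α∉⟨θ⟩ =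
  not-normal (fun α) (affine-normal-form α κ (proj₁ α-affine) (proj₂ α-affine) (proj₂ κ≡Lw)) S (λ x → proj₁ (α-fixes-S x))
  where
    open DihedralCoordinates n
    open DihedralAutomorphisms n
    h = proj₁ (odd⇒≡1+2* 2∤p)
    p-odd = proj₂ (odd⇒≡1+2* 2∤p)
    cofactor = prime-power-cofactor m p r prime distinct t
    βa = autC-on-a m as t β (p t ^ r t) as∈⟨a⟩ ∏as≡a (proj₁ (proj₂ (o[as] t))) β∈Aut[Cₜ]
    w = proj₁ βa
    κ = - + k
    α-affine = semidirect-affine α β k (1ℤ + w) α≡θᵏβ (proj₁ (proj₂ βa)) (proj₁ β∈Aut[Cₜ])
    open Affine α (1ℤ + w) κ (proj₁ α-affine) (proj₂ α-affine)
    αᵖ≡1 = affine-order (p t) (proj₁ (proj₂ o[α]))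
    pw≡0×w²≡0 = unipotent-of-order-p {h = h} (prime t) p-odd (proj₂ (proj₂ cofactor)) (r≥1 t)
                  (trans n≡∏ (proj₁ (proj₂ cofactor))) (proj₂ (proj₂ βa)) (proj₁ αᵖ≡1)
    pw≡0 = proj₁ pw≡0×w²≡0
    w²≡0 = proj₂ pw≡0×w²≡0
    w≢0 : ¬ w ≡ 0ℤ [mod n ]
    w≢0 w≡0 = α∉⟨θ⟩ (affine-θ-power k (+-identityʳ-mod 1ℤ w≡0) refl)
    κ≡Lw = p-torsion-multiple (prime t) pw≡0 (*-geometric≡0⇒p*≡0 {h = h} p-odd pw≡0 w²≡0 (proj₂ αᵖ≡1)) w≢0
    open CayleyAutomorphism n {h = h} (prime t) p-odd w (proj₁ κ≡Lw) w≢0 w²≡0 pw≡0
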